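{- Let $X=(x_1,x_2,\dots)$ be an infinite sequence of commuting variables and let $I=(i_1<i_2<\cdots<i_r)$ be an increasing sequence of positive integers. Define the alternating quasi-symmetric function $$V_I(X)=\sum_{\sigma\in\mathfrak S_r}\epsilon(\sigma)M_{(i_{\sigma(1)},\dots,i_{\sigma(r)})}(X),$$ and for distinct positive integers $k\ne l$ set $Q_{kl}=M_{(k,l)}(X)-M_{(l,k)}(X)$. Then: (i) if $r=2m$ is even, $V_I(X)={\rm Pf}\big(Q_{i_ki_l}\big)_{1\le k,l\le 2m}$; (ii) if $r=2m+1$ is odd, $V_I(X)=\sum_{k=1}^{2m+1}(-1)^{k-1}M_{(i_k)}(X)\,{\rm Pf}\big(Q_{i_pi_q}\big)_{1\le p,q\le 2m+1,\;p,q\ne k}$.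
   Context: For a sequence $J=(j_1,\dots,j_r)$ of positive integers, the monomial quasi-symmetric function is $M_J(X)=\sum_{k_1<k_2<\cdots<k_r}x_{k_1}^{j_1}x_{k_2}^{j_2}\cdots x_{k_r}^{j_r}$ (a formal power series). $\epsilon(\sigma)$ is the signature. For an antisymmetric $2m\times 2m$ matrix $Q$ (here with $Q_{kk}=0$), ${\rm Pf}(Q)=\sum_\sigma\epsilon(\sigma)Q_{\sigma(1)\sigma(2)}\cdots Q_{\sigma(2m-1)\sigma(2m)}$ over $\sigma\in\mathfrak S_{2m}$ with $\sigma(2i-1)<\sigma(2i)$ and $\sigma(1)<\sigma(3)<\cdots<\sigma(2m-1)$; the Pfaffian of the empty matrix is $1$. -}

module Defs where

open import Level using (Level)
open import Data.Bool using (Bool; true; false; _∧_; _∨_; not; if_then_else_)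
open import Data.Nat as ℕ using (ℕ; zero; suc; _<ᵇ_; _≡ᵇ_)
open import Data.Fin as Fin using (Fin; toℕ; combine; punchIn)
open import Data.List using (List; []; _∷_; map; foldr; concatMap; allFin; filterᵇ)
open import Data.Bool.ListAction using (and)
open import Algebra.Bundles using (CommutativeRing)

allFuns : (n m : ℕ) → List (Fin n → Fin m)
allFuns zero    m = (λ ()) ∷ []
allFuns (suc n) m =
  concatMap (λ f → map (λ a → λ { Fin.zero → a ; (Fin.suc i) → f i }) (allFin m)) (allFuns n m)

_<F_ : ∀ {n} → Fin n → Fin n → Bool
a <F b = toℕ a <ᵇ toℕ b

_==F_ : ∀ {n} → Fin n → Fin n → Bool
a ==F b = toℕ a ≡ᵇ toℕ b

allB : ∀ {n} → (Fin n → Bool) → Bool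
allB {n} p = and (map p (allFin n))

isInjective : ∀ {n} → (Fin n → Fin n) → Bool
isInjective σ = allB (λ a → allB (λ b → (a ==F b) ∨ not (σ a ==F σ b)))

perms : (n : ℕ) → List (Fin n → Fin n)
perms n = filterᵇ isInjective (allFuns n n)

inversions : ∀ {n} → (Fin n → Fin n) → ℕ
inversions {n} σ =
  foldr ℕ._+_ 0 (map (λ a → foldr ℕ._+_ 0 (map (λ b →
     if (a <F b) ∧ (σ b <F σ a) then 1 else 0) (allFin n))) (allFin n))

-- Pfaffian index condition for σ ∈ 𝔖_{2m}, with positions indexed as combine i e
-- (i : Fin m, e : Fin 2), i.e. 0-based position 2i+e:
-- σ(2i) < σ(2i+1), and σ(2i) < σ(2i+2).
pfCond : ∀ {m} → (Fin (m ℕ.* 2) → Fin (m ℕ.* 2)) → Bool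
pfCond {m} σ =
  allB (λ (i : Fin m) → σ (combine i Fin.zero) <F σ (combine i (Fin.suc Fin.zero)))
  ∧ allB (λ (i : Fin m) → allB (λ (j : Fin m) →
      not (toℕ j ≡ᵇ suc (toℕ i)) ∨ (σ (combine i Fin.zero) <F σ (combine j Fin.zero))))

module WithRing {c ℓ : Level} (R : CommutativeRing c ℓ) where
  open CommutativeRing R

  sumR : List Carrier → Carrier
  sumR = foldr _+_ 0#

  prodR : List Carrier → Carrier
  prodR = foldr _*_ 1#

  pow : Carrier → ℕ → Carrier
  pow x zero    = 1#
  pow x (suc n) = x * pow x n

  signPow : ℕ → Carrier
  signPow zero    = 1#
  signPow (suc n) = - signPow n

  ε : ∀ {n} → (Fin n → Fin n) → Carrier
  ε σ = signPow (inversions σ)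

  -- Monomial quasi-symmetric function M_J evaluated at finitely many variables
  -- xs = (x_1,…,x_N):  Σ_{k_1<…<k_r ≤ N} x_{k_1}^{j_1} ⋯ x_{k_r}^{j_r}.
  M : List ℕ → List Carrier → Carrier
  M []      xs       = 1#
  M (j ∷ J) []       = 0#
  M (j ∷ J) (y ∷ ys) = pow y j * M J ys + M (j ∷ J) ys

  listOf : ∀ {n} → (Fin n → ℕ) → List ℕ
  listOf {n} f = map f (allFin n)

  V : ∀ {r} → (Fin r → ℕ) → List Carrier → Carrier
  V {r} I xs = sumR (map (λ σ → ε σ * M (listOf (λ a → I (σ a))) xs) (perms r))

  Q : List Carrier → ℕ → ℕ → Carrier
  Q xs k l = M (k ∷ l ∷ []) xs - M (l ∷ k ∷ []) xs

  Pf : (m : ℕ) → (Fin (m ℕ.* 2) → Fin (m ℕ.* 2) → Carrier) → Carrier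
  Pf m A = sumR (map (λ σ → ε σ * prodR (map (λ (i : Fin m) →
                 A (σ (combine i Fin.zero)) (σ (combine i (Fin.suc Fin.zero)))) (allFin m)))
               (filterᵇ (pfCond {m}) (perms (m ℕ.* 2))))

{-# OPTIONS --safe #-}
-- Both sides are computed by splitting off the first variable y of xs = y ∷ ys.  Since
-- M_J(y ∷ ys) = y^{j₁} M_{(j₂,…)}(ys) + M_J(ys), the alternant obeys
--   V_L(y ∷ ys) = V_L(ys) + Σ_k (-1)^k y^{L_k} V_{L∖L_k}(ys),
-- while Q(y ∷ ys) = Q(ys) + u ∧ v with u_b = y^b and v_b = M_(b)(ys).  The Pfaffian of a rank-two
-- perturbation satisfies Pf(A + u ∧ v) = Pf(A) + Σ_{b ≠ c} ± u_b v_c Pf(A without b, c), with a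
-- bordered analogue in odd size, and Σ_c ± v_c Pf(A without b, c) is the odd-size right-hand side
-- for ys.  So induction on the number of variables proves (i) and (ii) together, once V and Pf,
-- sums over the whole symmetric group, are rewritten as expansions along the first index by
-- splitting a permutation σ into σ(0) and the induced permutation of the remaining entries.
module Submission where

open import Defs
open import Level using (Level)
open import Data.Nat using (ℕ; suc; _<_; _≤_) renaming (_*_ to _*ℕ_)
open import Data.Fin using (Fin; toℕ; punchIn) renaming (_<_ to _<ᶠ_)
open import Data.List using (List; map; allFin)
open import Data.Product using (_×_)
open import Algebra.Bundles using (CommutativeRing)

open import Algebra.Bundles using (CommutativeMonoid)
open import Data.Bool using (Bool; true; false; not; _∧_; _∨_; if_then_else_; T)
open import Data.Bool.ListAction using (and)
open import Data.Bool.Properties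
  using (∧-commutativeMonoid; ∧-assoc; ∧-idem; ∧-conicalˡ; ∧-conicalʳ; ∨-zeroʳ; ¬-not)
open import Data.Fin using (combine)
import Data.Fin as Fin
import Data.Fin.Properties as Fin
open import Data.List using ([]; _∷_; _++_; length; foldr; concatMap; filterᵇ; tabulate)
import Data.List.Properties as List
open import Data.List.Relation.Unary.All as All using (All; []; _∷_)
import Data.List.Relation.Unary.All.Properties as All
open import Data.Maybe using (nothing)
open import Data.Nat using (zero; s≤s; z≤n; pred; _<ᵇ_; _≡ᵇ_) renaming (_+_ to _+ℕ_)
import Data.Nat.Properties as ℕ
open import Data.Product using (_,_; proj₁; proj₂; ∃)
open import Data.Vec.Functional using () renaming (_∷_ to _∷ᶠ_)
open import Data.Vec.Functional.Properties using (∷-cong)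
open import Function using (_∘_; id)
open import Relation.Binary.PropositionalEquality as ≡ using (_≡_; _≢_; _≗_)
open import Relation.Nullary using (yes; no)
open import Tactic.RingSolver using (solve-∀)
open import Tactic.RingSolver.Core.AlmostCommutativeRing using (AlmostCommutativeRing; fromCommutativeRing)

open import Algebra.Properties.CommutativeSemigroup
  (CommutativeMonoid.commutativeSemigroup ∧-commutativeMonoid)
  using () renaming (interchange to ∧-interchange)
open import Algebra.Properties.CommutativeSemigroup ℕ.+-commutativeSemigroup
  using () renaming (x∙yz≈y∙xz to ℕ-x+[y+z]≡y+[x+z])

module RingIdentities {c ℓ} (R : CommutativeRing c ℓ) where
  private
    ring : AlmostCommutativeRing c ℓ
    ring = fromCommutativeRing R (λ _ → nothing)
  open AlmostCommutativeRing ring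

  [a+b]-[c+d]≈[a-c]+[b-d] : ∀ a b c d → (a + b) - (c + d) ≈ (a - c) + (b - d)
  [a+b]-[c+d]≈[a-c]+[b-d] = solve-∀ ring

  a+[c-b]≈[a-b]+c : ∀ a b c → a + (c - b) ≈ (a - b) + c
  a+[c-b]≈[a-b]+c = solve-∀ ring

  x[y[zp]]≈y[z[xp]] : ∀ x y z p → x * (y * (z * p)) ≈ y * (z * (x * p))
  x[y[zp]]≈y[z[xp]] = solve-∀ ring

  x[y[zp]]≈z[y[xp]] : ∀ x y z p → x * (y * (z * p)) ≈ z * (y * (x * p))
  x[y[zp]]≈z[y[xp]] = solve-∀ ring

  [p+x]+[y-z]≈p+[y+[x-z]] : ∀ p x y z → (p + x) + (y - z) ≈ p + (y + (x - z))
  [p+x]+[y-z]≈p+[y+[x-z]] = solve-∀ ring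

map-allFin-suc : ∀ {a} {A : Set a} {n} (f : Fin (suc n) → A) →
                 map f (allFin (suc n)) ≡ f Fin.zero ∷ map (f ∘ Fin.suc) (allFin n)
map-allFin-suc {n = n} f = begin
  map f (allFin (suc n))                    ≡⟨ List.map-tabulate id f ⟩
  tabulate f                                ≡⟨ ≡.cong (f Fin.zero ∷_) (List.map-tabulate id (f ∘ Fin.suc)) ⟨
  f Fin.zero ∷ map (f ∘ Fin.suc) (allFin n) ∎
  where open ≡.≡-Reasoning

module ListSums {c ℓ} (R : CommutativeRing c ℓ) where
  open CommutativeRing R
  open WithRing R using (sumR)
  open import Algebra.Properties.Ring ring using (-0#≈0#; -‿+-comm)
  open import Algebra.Properties.CommutativeSemigroup +-commutativeSemigroup using (interchange)

  ∑ : ∀ {a} {A : Set a} → List A → (A → Carrier) → Carrier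
  ∑ l f = sumR (map f l)

  when : Bool → Carrier → Carrier
  when b x = if b then x else 0#

  when-≡ : ∀ {b b′ x} → b ≡ b′ → when b x ≡ when b′ x
  when-≡ ≡.refl = ≡.refl

  when-cong : ∀ b {x y} → x ≈ y → when b x ≈ when b y
  when-cong true  x≈y = x≈y
  when-cong false _   = refl

  when-∧ : ∀ b₁ b₂ x → when (b₁ ∧ b₂) x ≡ when b₁ (when b₂ x)
  when-∧ true  _ _ = ≡.refl
  when-∧ false _ _ = ≡.refl

  module _ {a} {A : Set a} where
    ∑-cong : ∀ (l : List A) {f g : A → Carrier} → (∀ x → f x ≈ g x) → ∑ l f ≈ ∑ l g
    ∑-cong []      f≈g = refl
    ∑-cong (x ∷ l) f≈g = +-cong (f≈g x) (∑-cong l f≈g)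

    ∑-cong-All : ∀ {p} {P : A → Set p} {l : List A} {f g : A → Carrier} →
                 All P l → (∀ x → P x → f x ≈ g x) → ∑ l f ≈ ∑ l g
    ∑-cong-All []         f≈g = refl
    ∑-cong-All (px ∷ pxs) f≈g = +-cong (f≈g _ px) (∑-cong-All pxs f≈g)

    ∑-0 : ∀ (l : List A) {f : A → Carrier} → (∀ x → f x ≈ 0#) → ∑ l f ≈ 0#
    ∑-0 []      f≈0 = refl
    ∑-0 (x ∷ l) f≈0 = trans (+-cong (f≈0 x) (∑-0 l f≈0)) (+-identityʳ 0#)

    ∑-+ : ∀ (l : List A) (f g : A → Carrier) → ∑ l (λ x → f x + g x) ≈ ∑ l f + ∑ l g
    ∑-+ []      f g = sym (+-identityʳ 0#)
    ∑-+ (x ∷ l) f g = trans (+-congˡ (∑-+ l f g)) (interchange _ _ _ _)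

    ∑-* : ∀ (l : List A) (k : Carrier) (f : A → Carrier) → ∑ l (λ x → k * f x) ≈ k * ∑ l f
    ∑-* []      k f = sym (zeroʳ k)
    ∑-* (x ∷ l) k f = trans (+-congˡ (∑-* l k f)) (sym (distribˡ k _ _))

    ∑-neg : ∀ (l : List A) (f : A → Carrier) → ∑ l (λ x → - f x) ≈ - ∑ l f
    ∑-neg []      f = sym -0#≈0#
    ∑-neg (x ∷ l) f = trans (+-congˡ (∑-neg l f)) (-‿+-comm _ _)

    ∑-++ : ∀ (l l′ : List A) (f : A → Carrier) → ∑ (l ++ l′) f ≈ ∑ l f + ∑ l′ f
    ∑-++ []      l′ f = sym (+-identityˡ _)
    ∑-++ (x ∷ l) l′ f = trans (+-congˡ (∑-++ l l′ f)) (sym (+-assoc _ _ _))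

    ∑-filterᵇ : ∀ (p : A → Bool) (l : List A) (f : A → Carrier) →
                ∑ (filterᵇ p l) f ≈ ∑ l (λ x → when (p x) (f x))
    ∑-filterᵇ p []      f = refl
    ∑-filterᵇ p (x ∷ l) f with p x
    ... | true  = +-congˡ (∑-filterᵇ p l f)
    ... | false = trans (∑-filterᵇ p l f) (sym (+-identityˡ _))

    ∑-when : ∀ (l : List A) b (f : A → Carrier) → ∑ l (λ x → when b (f x)) ≈ when b (∑ l f)
    ∑-when l true  f = refl
    ∑-when l false f = ∑-0 l (λ _ → refl)

  module _ {a b} {A : Set a} {B : Set b} where
    ∑-map : ∀ (h : B → A) (l : List B) (f : A → Carrier) → ∑ (map h l) f ≡ ∑ l (f ∘ h)
    ∑-map h l f = ≡.cong (foldr _+_ 0#) (≡.sym (List.map-∘ l))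

    ∑-concatMap : ∀ (g : B → List A) (l : List B) (f : A → Carrier) →
                  ∑ (concatMap g l) f ≈ ∑ l (λ y → ∑ (g y) f)
    ∑-concatMap g []      f = refl
    ∑-concatMap g (y ∷ l) f = trans (∑-++ (g y) (concatMap g l) f) (+-congˡ (∑-concatMap g l f))

    ∑-swap : ∀ (l : List A) (l′ : List B) (f : A → B → Carrier) →
             ∑ l (λ x → ∑ l′ (f x)) ≈ ∑ l′ (λ y → ∑ l (λ x → f x y))
    ∑-swap []      l′ f = sym (∑-0 l′ (λ _ → refl))
    ∑-swap (x ∷ l) l′ f = trans (+-congˡ (∑-swap l l′ f)) (sym (∑-+ l′ (f x) _))

  ∑-allFin-suc : ∀ {n} (f : Fin (suc n) → Carrier) →
                 ∑ (allFin (suc n)) f ≈ f Fin.zero + ∑ (allFin n) (f ∘ Fin.suc)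
  ∑-allFin-suc f = reflexive (≡.cong sumR (map-allFin-suc f))

module Alternating {c ℓ} (R : CommutativeRing c ℓ) {x} (X : Set x) where
  open CommutativeRing R
  open RingIdentities R
  open import Algebra.Properties.Ring ring
    using (-0#≈0#; -‿+-comm; -‿involutive; x[y-z]≈xy-xz; ⁻¹-anti-homo‿-)
  open import Relation.Binary.Reasoning.Setoid setoid

  -- alt L f = Σ_k (-1)^k f L_k (L with its k-th entry deleted).
  alt : List X → (X → List X → Carrier) → Carrier
  alt []      f = 0#
  alt (b ∷ L) f = f b L - alt L (λ c L′ → f c (b ∷ L′))

  data Deletion : List X → List X → Set x where
    here  : ∀ {b L} → Deletion (b ∷ L) L
    there : ∀ {b L L′} → Deletion L L′ → Deletion (b ∷ L) (b ∷ L′)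

  Deletion-length : ∀ {L L′} → Deletion L L′ → length L ≡ suc (length L′)
  Deletion-length here      = ≡.refl
  Deletion-length (there d) = ≡.cong suc (Deletion-length d)

  Deletion-≤ : ∀ {L L′ n} → Deletion L L′ → length L ≤ n → length L′ ≤ n
  Deletion-≤ d len≤n = ℕ.≤-trans (ℕ.n≤1+n _) (≡.subst (_≤ _) (Deletion-length d) len≤n)

  alt-cong-Deletion : ∀ L {f g : X → List X → Carrier} →
                      (∀ b L′ → Deletion L L′ → f b L′ ≈ g b L′) → alt L f ≈ alt L g
  alt-cong-Deletion []      f≈g = refl
  alt-cong-Deletion (b ∷ L) f≈g =
    +-cong (f≈g b L here) (-‿cong (alt-cong-Deletion L (λ c L′ d → f≈g c (b ∷ L′) (there d))))

  alt-cong : ∀ L {f g : X → List X → Carrier} → (∀ b L′ → f b L′ ≈ g b L′) → alt L f ≈ alt L g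
  alt-cong L f≈g = alt-cong-Deletion L (λ b L′ _ → f≈g b L′)

  alt-0 : ∀ L → alt L (λ _ _ → 0#) ≈ 0#
  alt-0 []      = refl
  alt-0 (b ∷ L) = trans (+-congˡ (-‿cong (alt-0 L))) (-‿inverseʳ 0#)

  alt-+ : ∀ L f g → alt L (λ b L′ → f b L′ + g b L′) ≈ alt L f + alt L g
  alt-+ []      f g = sym (+-identityʳ 0#)
  alt-+ (b ∷ L) f g = trans (+-congˡ (-‿cong (alt-+ L _ _))) ([a+b]-[c+d]≈[a-c]+[b-d] _ _ _ _)

  alt-neg : ∀ L f → alt L (λ b L′ → - f b L′) ≈ - alt L f
  alt-neg []      f = sym -0#≈0#
  alt-neg (b ∷ L) f = trans (+-congˡ (-‿cong (alt-neg L _))) (-‿+-comm _ _)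

  alt-- : ∀ L f g → alt L (λ b L′ → f b L′ - g b L′) ≈ alt L f - alt L g
  alt-- L f g = trans (alt-+ L f (λ b L′ → - g b L′)) (+-congˡ (alt-neg L g))

  alt-* : ∀ L k f → alt L (λ b L′ → k * f b L′) ≈ k * alt L f
  alt-* []      k f = sym (zeroʳ k)
  alt-* (b ∷ L) k f = trans (+-congˡ (-‿cong (alt-* L k _))) (sym (x[y-z]≈xy-xz k _ _))

  -- altPairs L h = Σ_{i<j} (-1)^{i+j+1} h L_i L_j (L with its i-th and j-th entries deleted).
  altPairs : List X → (X → X → List X → Carrier) → Carrier
  altPairs []      h = 0#
  altPairs (b ∷ L) h = alt L (h b) + altPairs L (λ c d R → h c d (b ∷ R))

  altPairs-cong : ∀ L {h h′ : X → X → List X → Carrier} →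
                  (∀ b c R → h b c R ≈ h′ b c R) → altPairs L h ≈ altPairs L h′
  altPairs-cong []      h≈h′ = refl
  altPairs-cong (b ∷ L) h≈h′ =
    +-cong (alt-cong L (h≈h′ b)) (altPairs-cong L (λ c d R → h≈h′ c d (b ∷ R)))

  altPairs-0 : ∀ L → altPairs L (λ _ _ _ → 0#) ≈ 0#
  altPairs-0 []      = refl
  altPairs-0 (b ∷ L) = trans (+-cong (alt-0 L) (altPairs-0 L)) (+-identityʳ 0#)

  altPairs-neg : ∀ L h → altPairs L (λ b c R → - h b c R) ≈ - altPairs L h
  altPairs-neg []      h = sym -0#≈0#
  altPairs-neg (b ∷ L) h = trans (+-cong (alt-neg L _) (altPairs-neg L _)) (-‿+-comm _ _)

  alt² : List X → (X → X → List X → Carrier) → Carrier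
  alt² L g = alt L (λ b L′ → alt L′ (g b))

  alt²≈altPairs : ∀ L g → alt² L g ≈ altPairs L (λ b c R → g b c R - g c b R)
  alt²≈altPairs []      g = refl
  alt²≈altPairs (b ∷ L) g = begin
    alt L (g b) - alt L (λ c L′ → g c b L′ - alt L′ (λ d L″ → g c d (b ∷ L″)))
      ≈⟨ +-congˡ (-‿cong (alt-- L _ _)) ⟩
    alt L (g b) - (alt L (λ c L′ → g c b L′) - alt² L (λ c d R → g c d (b ∷ R)))
      ≈⟨ trans (+-congˡ (⁻¹-anti-homo‿- _ _)) (a+[c-b]≈[a-b]+c _ _ _) ⟩
    (alt L (g b) - alt L (λ c L′ → g c b L′)) + alt² L (λ c d R → g c d (b ∷ R))
      ≈⟨ +-cong (sym (alt-- L _ _)) (alt²≈altPairs L _) ⟩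
    alt L (λ c R → g b c R - g c b R) + altPairs L (λ c d R → g c d (b ∷ R) - g d c (b ∷ R)) ∎

  alt²-antisym : ∀ L g → alt² L g ≈ - alt² L (λ b c → g c b)
  alt²-antisym L g = begin
    alt² L g                                            ≈⟨ alt²≈altPairs L g ⟩
    altPairs L (λ b c R → g b c R - g c b R)            ≈⟨ altPairs-cong L (λ b c R → ⁻¹-anti-homo‿- _ _) ⟨
    altPairs L (λ b c R → - (g c b R - g b c R))        ≈⟨ altPairs-neg L _ ⟩
    - altPairs L (λ b c R → g c b R - g b c R)          ≈⟨ -‿cong (alt²≈altPairs L _) ⟨
    - alt² L (λ b c → g c b)                            ∎

  alt²-sym : ∀ L g → (∀ b c R → g b c R ≈ g c b R) → alt² L g ≈ 0#
  alt²-sym L g sym-g = begin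
    alt² L g                                  ≈⟨ alt²≈altPairs L g ⟩
    altPairs L (λ b c R → g b c R - g c b R)  ≈⟨ altPairs-cong L cancel ⟩
    altPairs L (λ _ _ _ → 0#)                 ≈⟨ altPairs-0 L ⟩
    0#                                        ∎
    where
    cancel : ∀ b c R → g b c R - g c b R ≈ 0#
    cancel b c R = trans (+-congʳ (sym-g b c R)) (-‿inverseʳ _)

  alt³ : List X → (X → X → X → List X → Carrier) → Carrier
  alt³ L f = alt L (λ b L′ → alt² L′ (f b))

  alt³-cong : ∀ L {f g : X → X → X → List X → Carrier} →
              (∀ b c d R → f b c d R ≈ g b c d R) → alt³ L f ≈ alt³ L g
  alt³-cong L f≈g = alt-cong L (λ b L′ → alt-cong L′ (λ c L″ → alt-cong L″ (f≈g b c)))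

  alt³-swap₁₂ : ∀ L f → alt³ L f ≈ - alt³ L (λ b c → f c b)
  alt³-swap₁₂ L f = alt²-antisym L (λ b c L″ → alt L″ (f b c))

  alt³-swap₂₃ : ∀ L f → alt³ L f ≈ - alt³ L (λ b c d → f b d c)
  alt³-swap₂₃ L f = trans (alt-cong L (λ b L′ → alt²-antisym L′ (f b))) (alt-neg L _)

  alt³-rotate : ∀ L f → alt³ L (λ b c d → f d b c) ≈ alt³ L f
  alt³-rotate L f = begin
    alt³ L (λ b c d → f d b c)    ≈⟨ alt³-swap₂₃ L _ ⟩
    - alt³ L (λ b c d → f c b d)  ≈⟨ -‿cong (alt³-swap₁₂ L _) ⟩
    - - alt³ L f                  ≈⟨ -‿involutive _ ⟩
    alt³ L f                      ∎

  alt³-sym₁₃ : ∀ L f → (∀ b c d R → f b c d R ≈ f d c b R) → alt³ L f ≈ 0#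
  alt³-sym₁₃ L f sym-f = begin
    alt³ L f                  ≈⟨ alt³-swap₁₂ L f ⟩
    - alt³ L (λ b c → f c b)  ≈⟨ -‿cong (alt-cong L λ b L′ → alt²-sym L′ _ (λ c d → sym-f c b d)) ⟩
    - alt L (λ _ _ → 0#)      ≈⟨ -‿cong (alt-0 L) ⟩
    - 0#                      ≈⟨ -0#≈0# ⟩
    0#                        ∎

module ListPfaffian {c ℓ} (R : CommutativeRing c ℓ) {x} (X : Set x) where
  open CommutativeRing R
  open Alternating R X
  open RingIdentities R
  open import Algebra.Properties.Ring ring using (⁻¹-anti-homo‿-; x[y-z]≈xy-xz; [y-z]x≈yx-zx)
  open import Algebra.Properties.CommutativeSemigroup *-commutativeSemigroup using (x∙yz≈y∙xz; xy∙z≈y∙xz)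
  open import Relation.Binary.Reasoning.Setoid setoid

  -- The Pfaffian of the principal submatrix of A on the index list L, expanded along its first
  -- row; the fuel only serves termination, and lists of odd length get 0#.
  pfFuel : (X → X → Carrier) → ℕ → List X → Carrier
  pfFuel A _       []      = 1#
  pfFuel A zero    (a ∷ L) = 0#
  pfFuel A (suc n) (a ∷ L) = alt L (λ b L′ → A a b * pfFuel A n L′)

  pf : (X → X → Carrier) → List X → Carrier
  pf A L = pfFuel A (length L) L

  pfFuel-fuel : ∀ A n k L → length L ≤ n → length L ≤ k → pfFuel A n L ≈ pfFuel A k L
  pfFuel-fuel A n       k       []      _           _           = refl
  pfFuel-fuel A (suc n) (suc k) (a ∷ L) (s≤s len≤n) (s≤s len≤k) = alt-cong-Deletion L λ b L′ d →
    *-congˡ (pfFuel-fuel A n k L′ (Deletion-≤ d len≤n) (Deletion-≤ d len≤k))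

  pf-∷ : ∀ A a L → pf A (a ∷ L) ≈ alt L (λ b L′ → A a b * pf A L′)
  pf-∷ A a L = alt-cong-Deletion L λ b L′ d →
    *-congˡ (pfFuel-fuel A _ _ L′ (Deletion-≤ d ℕ.≤-refl) ℕ.≤-refl)

  pfFuel-cong : ∀ {A A′} → (∀ a b → A a b ≈ A′ a b) → ∀ n L → pfFuel A n L ≈ pfFuel A′ n L
  pfFuel-cong A≈A′ _       []      = refl
  pfFuel-cong A≈A′ zero    (a ∷ L) = refl
  pfFuel-cong A≈A′ (suc n) (a ∷ L) = alt-cong L (λ b L′ → *-cong (A≈A′ a b) (pfFuel-cong A≈A′ n L′))

  pf-cong : ∀ {A A′} → (∀ a b → A a b ≈ A′ a b) → ∀ L → pf A L ≈ pf A′ L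
  pf-cong A≈A′ L = pfFuel-cong A≈A′ (length L) L

  -- For L of odd length this is the Pfaffian of A bordered by the row v.
  pfBorder : (X → Carrier) → (X → X → Carrier) → List X → Carrier
  pfBorder v A L = alt L (λ b L′ → v b * pf A L′)

  pfBorder₂ : (X → Carrier) → (X → Carrier) → (X → X → Carrier) → List X → Carrier
  pfBorder₂ u v A L = alt L (λ b L′ → u b * pfBorder v A L′)

  addWedge : (X → X → Carrier) → (X → Carrier) → (X → Carrier) → X → X → Carrier
  addWedge A u v a b = A a b + (u a * v b - u b * v a)

  addWedge-* : ∀ A (u v : X → Carrier) a b q →
               addWedge A u v a b * q ≈ A a b * q + (u a * (v b * q) - v a * (u b * q))
  addWedge-* A u v a b q = trans (distribʳ q _ _)
    (+-congˡ (trans ([y-z]x≈yx-zx q _ _) (+-cong (*-assoc _ _ _) (-‿cong (xy∙z≈y∙xz _ _ _)))))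

  addWedge-shift : ∀ A (u v : X → Carrier) a b →
                   addWedge A u v a b ≈ addWedge A u (λ c → u c + v c) a b
  addWedge-shift A u v a b = +-congˡ (sym (begin
    u a * (u b + v b) - u b * (u a + v a)              ≈⟨ +-cong (distribˡ _ _ _) (-‿cong (distribˡ _ _ _)) ⟩
    (u a * u b + u a * v b) - (u b * u a + u b * v a)  ≈⟨ [a+b]-[c+d]≈[a-c]+[b-d] _ _ _ _ ⟩
    (u a * u b - u b * u a) + (u a * v b - u b * v a)  ≈⟨ +-congʳ (trans (+-congʳ (*-comm _ _)) (-‿inverseʳ _)) ⟩
    0# + (u a * v b - u b * v a)                       ≈⟨ +-identityˡ _ ⟩
    u a * v b - u b * v a                              ∎))

  alt-nested : ∀ L (x y : X → Carrier) (h : X → List X → Carrier) →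
               alt L (λ b L′ → x b * alt L′ (λ c L″ → y c * alt L″ h))
               ≈ alt³ L (λ b c d R → x b * (y c * h d R))
  alt-nested L x y h = alt-cong L λ b L′ → begin
    x b * alt L′ (λ c L″ → y c * alt L″ h)
      ≈⟨ alt-* L′ (x b) _ ⟨
    alt L′ (λ c L″ → x b * (y c * alt L″ h))
      ≈⟨ alt-cong L′ (λ c L″ → *-congˡ (alt-* L″ (y c) h)) ⟨
    alt L′ (λ c L″ → x b * alt L″ (λ d R → y c * h d R))
      ≈⟨ alt-cong L′ (λ c L″ → alt-* L″ (x b) _) ⟨
    alt² L′ (λ c d R → x b * (y c * h d R)) ∎

  module RankTwo (A : X → X → Carrier) (u v : X → Carrier) where

    uvRow : X → List X → Carrier
    uvRow a L = alt L (λ b L′ → u b * alt L′ (λ c L″ → v c * alt L″ (λ d R → A a d * pf A R)))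

    alt-row-pfBorder₂ : ∀ a L → alt L (λ b L′ → A a b * pfBorder₂ u v A L′) ≈ uvRow a L
    alt-row-pfBorder₂ a L = begin
      alt L (λ b L′ → A a b * pfBorder₂ u v A L′)
        ≈⟨ alt-nested L (A a) u _ ⟩
      alt³ L (λ b c d R → A a b * (u c * (v d * pf A R)))
        ≈⟨ alt³-rotate L _ ⟨
      alt³ L (λ b c d R → A a d * (u b * (v c * pf A R)))
        ≈⟨ alt³-cong L (λ _ _ _ _ → x[y[zp]]≈y[z[xp]] _ _ _ _) ⟩
      alt³ L (λ b c d R → u b * (v c * (A a d * pf A R)))
        ≈⟨ alt-nested L u v _ ⟨
      uvRow a L ∎

    alt-v-pfBorder₂≈0 : ∀ L → alt L (λ b L′ → v b * pfBorder₂ u v A L′) ≈ 0#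
    alt-v-pfBorder₂≈0 L = trans (alt-nested L v u _)
      (alt³-sym₁₃ L _ (λ _ _ _ _ → x[y[zp]]≈z[y[xp]] _ _ _ _))

    alt-u-pfBorder₂≈0 : ∀ L → alt L (λ b L′ → u b * pfBorder₂ u v A L′) ≈ 0#
    alt-u-pfBorder₂≈0 L = trans (alt-cong L (λ b L′ → sym (alt-* L′ (u b) _)))
      (alt²-sym L _ (λ _ _ _ → x∙yz≈y∙xz _ _ _))

    alt-border-pf+pfBorder₂ : ∀ (w : X → Carrier) L →
      alt L (λ b L′ → w b * (pf A L′ + pfBorder₂ u v A L′))
      ≈ pfBorder w A L + alt L (λ b L′ → w b * pfBorder₂ u v A L′)
    alt-border-pf+pfBorder₂ w L = trans (alt-cong L (λ b L′ → distribˡ _ _ _)) (alt-+ L _ _)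

    pfBorder₂-∷ : ∀ a L →
      pfBorder₂ u v A (a ∷ L) ≈ u a * pfBorder v A L - (v a * pfBorder u A L - uvRow a L)
    pfBorder₂-∷ a L = +-congˡ (-‿cong (begin
      alt L (λ b L′ → u b * (v a * pf A L′ - alt L′ (λ c L″ → v c * pf A (a ∷ L″))))
        ≈⟨ alt-cong L (λ b L′ → *-congˡ (+-congˡ (-‿cong (alt-cong L′ λ c L″ →
             *-congˡ (pf-∷ A a L″))))) ⟩
      alt L (λ b L′ → u b * (v a * pf A L′ - alt L′ (λ c L″ → v c * alt L″ (λ d R → A a d * pf A R))))
        ≈⟨ alt-cong L (λ b L′ → trans (x[y-z]≈xy-xz _ _ _) (+-congʳ (x∙yz≈y∙xz _ _ _))) ⟩
      alt L (λ b L′ → v a * (u b * pf A L′)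
                      - u b * alt L′ (λ c L″ → v c * alt L″ (λ d R → A a d * pf A R)))
        ≈⟨ trans (alt-- L _ _) (+-congʳ (alt-* L _ _)) ⟩
      v a * pfBorder u A L - uvRow a L ∎))

    -- Expanding along the first row, the cross terms where u or v meets pfBorder₂ u v vanish (a
    -- repeated border row), and the A-row term is the uvRow correction inside pfBorder₂-∷.
    pf-addWedge : ∀ L → pf (addWedge A u v) L ≈ pf A L + pfBorder₂ u v A L
    pf-addWedge L = go (length L) L ℕ.≤-refl
      where
      B : X → X → Carrier
      B = addWedge A u v
      go : ∀ n L → length L ≤ n → pf B L ≈ pf A L + pfBorder₂ u v A L
      go n       []      _           = sym (+-identityʳ 1#)
      go (suc n) (a ∷ L) (s≤s len≤n) = begin
        pf B (a ∷ L)
          ≈⟨ pf-∷ B a L ⟩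
        alt L (λ b L′ → B a b * pf B L′)
          ≈⟨ alt-cong-Deletion L (λ b L′ d → *-congˡ (go n L′ (Deletion-≤ d len≤n))) ⟩
        alt L (λ b L′ → B a b * PC L′)
          ≈⟨ alt-cong L (λ b L′ → addWedge-* A u v a b _) ⟩
        alt L (λ b L′ → A a b * PC L′ + (u a * (v b * PC L′) - v a * (u b * PC L′)))
          ≈⟨ trans (alt-+ L _ _) (+-congˡ (trans (alt-- L _ _) (+-cong (alt-* L _ _) (-‿cong (alt-* L _ _))))) ⟩
        alt L (λ b L′ → A a b * PC L′)
          + (u a * alt L (λ b L′ → v b * PC L′) - v a * alt L (λ b L′ → u b * PC L′))
          ≈⟨ +-cong (trans (alt-border-pf+pfBorder₂ (A a) L) (+-cong (sym (pf-∷ A a L)) (alt-row-pfBorder₂ a L)))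
                    (+-cong (*-congˡ (border v (alt-v-pfBorder₂≈0 L)))
                            (-‿cong (*-congˡ (border u (alt-u-pfBorder₂≈0 L))))) ⟩
        (pf A (a ∷ L) + uvRow a L) + (u a * pfBorder v A L - v a * pfBorder u A L)
          ≈⟨ [p+x]+[y-z]≈p+[y+[x-z]] _ _ _ _ ⟩
        pf A (a ∷ L) + (u a * pfBorder v A L + (uvRow a L - v a * pfBorder u A L))
          ≈⟨ +-congˡ (+-congˡ (⁻¹-anti-homo‿- _ _)) ⟨
        pf A (a ∷ L) + (u a * pfBorder v A L - (v a * pfBorder u A L - uvRow a L))
          ≈⟨ +-congˡ (pfBorder₂-∷ a L) ⟨
        pf A (a ∷ L) + pfBorder₂ u v A (a ∷ L) ∎
        where
        PC : List X → Carrier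
        PC L′ = pf A L′ + pfBorder₂ u v A L′
        border : ∀ w → alt L (λ b L′ → w b * pfBorder₂ u v A L′) ≈ 0# →
                 alt L (λ b L′ → w b * PC L′) ≈ pfBorder w A L
        border w vanish = trans (alt-border-pf+pfBorder₂ w L) (trans (+-congˡ vanish) (+-identityʳ _))

  pfBorder-addWedge : ∀ A (u v : X → Carrier) L →
    pfBorder (λ b → u b + v b) (addWedge A u v) L ≈ pfBorder v A L + pfBorder u A L
  pfBorder-addWedge A u v L = begin
    alt L (λ b L′ → w b * pf (addWedge A u v) L′)
      ≈⟨ alt-cong L (λ b L′ → *-congˡ (pf-cong (addWedge-shift A u v) L′)) ⟩
    alt L (λ b L′ → w b * pf (addWedge A u w) L′)
      ≈⟨ alt-cong L (λ b L′ → *-congˡ (RankTwo.pf-addWedge A u w L′)) ⟩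
    alt L (λ b L′ → w b * (pf A L′ + pfBorder₂ u w A L′))
      ≈⟨ trans (RankTwo.alt-border-pf+pfBorder₂ A u w w L) (+-congˡ (RankTwo.alt-v-pfBorder₂≈0 A u w L)) ⟩
    pfBorder w A L + 0#
      ≈⟨ +-identityʳ _ ⟩
    alt L (λ b L′ → w b * pf A L′)
      ≈⟨ alt-cong L (λ b L′ → trans (distribʳ _ _ _) (+-comm _ _)) ⟩
    alt L (λ b L′ → v b * pf A L′ + u b * pf A L′)
      ≈⟨ alt-+ L _ _ ⟩
    pfBorder v A L + pfBorder u A L ∎
    where
    w : X → Carrier
    w b = u b + v b

module QuasiSymmetricLists {c ℓ} (R : CommutativeRing c ℓ) where
  open CommutativeRing R
  open WithRing R using (M; Q; pow)
  open RingIdentities R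
  open Alternating R ℕ
  open ListPfaffian R ℕ
  open import Relation.Binary.Reasoning.Setoid setoid

  -- V′ L xs is V_L(xs), computed by the first-variable recursion.
  V′ : List ℕ → List Carrier → Carrier
  V′ L       (y ∷ ys) = V′ L ys + alt L (λ b L′ → pow y b * V′ L′ ys)
  V′ []      []       = 1#
  V′ (_ ∷ _) []       = 0#

  M₁ : List Carrier → ℕ → Carrier
  M₁ xs b = M (b ∷ []) xs

  M₁-∷ : ∀ y ys b → M₁ (y ∷ ys) b ≈ pow y b + M₁ ys b
  M₁-∷ y ys b = +-congʳ (*-identityʳ _)

  Q-∷ : ∀ y ys a b → Q (y ∷ ys) a b ≈ addWedge (Q ys) (pow y) (M₁ ys) a b
  Q-∷ y ys a b = trans ([a+b]-[c+d]≈[a-c]+[b-d] _ _ _ _) (+-comm _ _)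

  Deletion-even : ∀ m {L L′} → Deletion L L′ → length L ≡ m *ℕ 2 → length L′ ≡ suc (pred m *ℕ 2)
  Deletion-even zero    d len with () ← ≡.trans (≡.sym (Deletion-length d)) len
  Deletion-even (suc m) d len = ℕ.suc-injective (≡.trans (≡.sym (Deletion-length d)) len)

  Deletion-odd : ∀ m {L L′} → Deletion L L′ → length L ≡ suc (m *ℕ 2) → length L′ ≡ m *ℕ 2
  Deletion-odd m d len = ℕ.suc-injective (≡.trans (≡.sym (Deletion-length d)) len)

  V′-even : ∀ xs m L → length L ≡ m *ℕ 2 → V′ L xs ≈ pf (Q xs) L
  V′-odd  : ∀ xs m L → length L ≡ suc (m *ℕ 2) → V′ L xs ≈ pfBorder (M₁ xs) (Q xs) L

  V′-even []       m []      _   = refl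
  V′-even []       m (a ∷ L) _   = sym (begin
    pf (Q []) (a ∷ L)                  ≈⟨ pf-∷ (Q []) a L ⟩
    alt L (λ b L′ → (0# - 0#) * _)     ≈⟨ alt-cong L (λ _ _ → trans (*-congʳ (-‿inverseʳ 0#)) (zeroˡ _)) ⟩
    alt L (λ _ _ → 0#)                 ≈⟨ alt-0 L ⟩
    0#                                 ∎)
  V′-even (y ∷ ys) m L len = begin
    V′ L ys + alt L (λ b L′ → pow y b * V′ L′ ys)
      ≈⟨ +-cong (V′-even ys m L len)
                (alt-cong-Deletion L (λ b L′ d → *-congˡ (V′-odd ys (pred m) L′ (Deletion-even m d len)))) ⟩
    pf (Q ys) L + pfBorder₂ (pow y) (M₁ ys) (Q ys) L
      ≈⟨ RankTwo.pf-addWedge (Q ys) (pow y) (M₁ ys) L ⟨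
    pf (addWedge (Q ys) (pow y) (M₁ ys)) L
      ≈⟨ pf-cong (λ a b → sym (Q-∷ y ys a b)) L ⟩
    pf (Q (y ∷ ys)) L ∎

  V′-odd []       m []      ()
  V′-odd []       m (a ∷ L) _   =
    sym (trans (alt-cong (a ∷ L) (λ b L′ → zeroˡ (pf (Q []) L′))) (alt-0 (a ∷ L)))
  V′-odd (y ∷ ys) m L len = begin
    V′ L ys + alt L (λ b L′ → pow y b * V′ L′ ys)
      ≈⟨ +-cong (V′-odd ys m L len)
                (alt-cong-Deletion L (λ b L′ d → *-congˡ (V′-even ys m L′ (Deletion-odd m d len)))) ⟩
    pfBorder (M₁ ys) (Q ys) L + pfBorder (pow y) (Q ys) L
      ≈⟨ pfBorder-addWedge (Q ys) (pow y) (M₁ ys) L ⟨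
    pfBorder (λ b → pow y b + M₁ ys b) (addWedge (Q ys) (pow y) (M₁ ys)) L
      ≈⟨ alt-cong L (λ b L′ → *-cong (sym (M₁-∷ y ys b)) (pf-cong (λ a b → sym (Q-∷ y ys a b)) L′)) ⟩
    pfBorder (M₁ (y ∷ ys)) (Q (y ∷ ys)) L ∎

allB-suc : ∀ {n} (p : Fin (suc n) → Bool) → allB p ≡ p Fin.zero ∧ allB (p ∘ Fin.suc)
allB-suc p = ≡.cong and (map-allFin-suc p)

allB-cong : ∀ {n} {p q : Fin n → Bool} → p ≗ q → allB p ≡ allB q
allB-cong {n} p≗q = ≡.cong and (List.map-cong p≗q (allFin n))

allB-∧ : ∀ n (p q : Fin n → Bool) → allB (λ x → p x ∧ q x) ≡ allB p ∧ allB q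
allB-∧ zero    p q = ≡.refl
allB-∧ (suc n) p q = begin
  allB (λ x → p x ∧ q x)
    ≡⟨ allB-suc (λ x → p x ∧ q x) ⟩
  (p₀ ∧ q₀) ∧ allB (λ x → p (Fin.suc x) ∧ q (Fin.suc x))
    ≡⟨ ≡.cong ((p₀ ∧ q₀) ∧_) (allB-∧ n _ _) ⟩
  (p₀ ∧ q₀) ∧ (allB (p ∘ Fin.suc) ∧ allB (q ∘ Fin.suc))
    ≡⟨ ∧-interchange p₀ q₀ _ _ ⟩
  (p₀ ∧ allB (p ∘ Fin.suc)) ∧ (q₀ ∧ allB (q ∘ Fin.suc))
    ≡⟨ ≡.cong₂ _∧_ (allB-suc p) (allB-suc q) ⟨
  allB p ∧ allB q ∎
  where
  open ≡.≡-Reasoning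
  p₀ q₀ : Bool
  p₀ = p Fin.zero
  q₀ = q Fin.zero

allB-true : ∀ n → allB {n} (λ _ → true) ≡ true
allB-true zero    = ≡.refl
allB-true (suc n) = ≡.trans (allB-suc {n} (λ _ → true)) (allB-true n)

allB-elim : ∀ {n} (p : Fin n → Bool) → allB p ≡ true → ∀ x → p x ≡ true
allB-elim {suc n} p all-p x with p Fin.zero in p₀ | ≡.trans (≡.sym (allB-suc p)) all-p
allB-elim {suc n} p all-p Fin.zero    | true | _      = p₀
allB-elim {suc n} p all-p (Fin.suc x) | true | all-p′ = allB-elim (p ∘ Fin.suc) all-p′ x

∑ℕ : ∀ n → (Fin n → ℕ) → ℕ
∑ℕ n g = foldr _+ℕ_ 0 (map g (allFin n))

∑ℕ-suc : ∀ n (g : Fin (suc n) → ℕ) → ∑ℕ (suc n) g ≡ g Fin.zero +ℕ ∑ℕ n (g ∘ Fin.suc)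
∑ℕ-suc n g = ≡.cong (foldr _+ℕ_ 0) (map-allFin-suc g)

∑ℕ-cong : ∀ n {g h : Fin n → ℕ} → g ≗ h → ∑ℕ n g ≡ ∑ℕ n h
∑ℕ-cong n g≗h = ≡.cong (foldr _+ℕ_ 0) (List.map-cong g≗h (allFin n))

∑ℕ-punchIn : ∀ n (k : Fin (suc n)) (g : Fin (suc n) → ℕ) →
             ∑ℕ (suc n) g ≡ g k +ℕ ∑ℕ n (g ∘ punchIn k)
∑ℕ-punchIn n       Fin.zero    g = ∑ℕ-suc n g
∑ℕ-punchIn (suc n) (Fin.suc k) g = begin
  ∑ℕ (suc (suc n)) g
    ≡⟨ ∑ℕ-suc (suc n) g ⟩
  g₀ +ℕ ∑ℕ (suc n) (g ∘ Fin.suc)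
    ≡⟨ ≡.cong (g₀ +ℕ_) (∑ℕ-punchIn n k (g ∘ Fin.suc)) ⟩
  g₀ +ℕ (g (Fin.suc k) +ℕ ∑ℕ n (g ∘ Fin.suc ∘ punchIn k))
    ≡⟨ ℕ-x+[y+z]≡y+[x+z] g₀ (g (Fin.suc k)) _ ⟩
  g (Fin.suc k) +ℕ (g₀ +ℕ ∑ℕ n (g ∘ Fin.suc ∘ punchIn k))
    ≡⟨ ≡.cong (g (Fin.suc k) +ℕ_) (∑ℕ-suc n _) ⟨
  g (Fin.suc k) +ℕ ∑ℕ (suc n) (g ∘ punchIn (Fin.suc k)) ∎
  where
  open ≡.≡-Reasoning
  g₀ : ℕ
  g₀ = g Fin.zero

below : ∀ {n} → ℕ → Fin n → ℕ
below t d = if toℕ d <ᵇ t then 1 else 0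

∑ℕ-below : ∀ n t → t ≤ n → ∑ℕ n (below t) ≡ t
∑ℕ-below zero    zero    _         = ≡.refl
∑ℕ-below (suc n) zero    _         = ≡.trans (∑ℕ-suc n (below 0)) (∑ℕ-below n zero z≤n)
∑ℕ-below (suc n) (suc t) (s≤s t≤n) = ≡.trans (∑ℕ-suc n (below (suc t))) (≡.cong suc (∑ℕ-below n t t≤n))

punchIn-==F : ∀ {n} (k : Fin (suc n)) (x y : Fin n) → (punchIn k x ==F punchIn k y) ≡ (x ==F y)
punchIn-==F Fin.zero    x           y           = ≡.refl
punchIn-==F (Fin.suc k) Fin.zero    Fin.zero    = ≡.refl
punchIn-==F (Fin.suc k) Fin.zero    (Fin.suc y) = ≡.refl
punchIn-==F (Fin.suc k) (Fin.suc x) Fin.zero    = ≡.refl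
punchIn-==F (Fin.suc k) (Fin.suc x) (Fin.suc y) = punchIn-==F k x y

punchIn-<F : ∀ {n} (k : Fin (suc n)) (x y : Fin n) → (punchIn k x <F punchIn k y) ≡ (x <F y)
punchIn-<F Fin.zero    x           y           = ≡.refl
punchIn-<F (Fin.suc k) Fin.zero    Fin.zero    = ≡.refl
punchIn-<F (Fin.suc k) Fin.zero    (Fin.suc y) = ≡.refl
punchIn-<F (Fin.suc k) (Fin.suc x) Fin.zero    = ≡.refl
punchIn-<F (Fin.suc k) (Fin.suc x) (Fin.suc y) = punchIn-<F k x y

punchIn-<ᵇ-pivot : ∀ {n} (k : Fin (suc n)) (x : Fin n) →
                   (toℕ (punchIn k x) <ᵇ toℕ k) ≡ (toℕ x <ᵇ toℕ k)
punchIn-<ᵇ-pivot Fin.zero    x           = ≡.refl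
punchIn-<ᵇ-pivot (Fin.suc k) Fin.zero    = ≡.refl
punchIn-<ᵇ-pivot (Fin.suc k) (Fin.suc x) = punchIn-<ᵇ-pivot k x

injectiveᵇ : ∀ {n m} → (Fin n → Fin m) → Bool
injectiveᵇ σ = allB (λ a → allB (λ b → (a ==F b) ∨ not (σ a ==F σ b)))

avoidsᵇ : ∀ {n m} → Fin m → (Fin n → Fin m) → Bool
avoidsᵇ a f = allB (λ y → not (a ==F f y))

injectiveᵇ-cong : ∀ {n m} {f g : Fin n → Fin m} → f ≗ g → injectiveᵇ f ≡ injectiveᵇ g
injectiveᵇ-cong f≗g = allB-cong λ a → allB-cong λ b →
  ≡.cong (λ z → (a ==F b) ∨ not z) (≡.cong₂ _==F_ (f≗g a) (f≗g b))

avoidsᵇ-cong : ∀ {n m} (a : Fin m) {f g : Fin n → Fin m} → f ≗ g → avoidsᵇ a f ≡ avoidsᵇ a g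
avoidsᵇ-cong a f≗g = allB-cong (λ y → ≡.cong (λ z → not (a ==F z)) (f≗g y))

==F-sym : ∀ {n} (a b : Fin n) → (a ==F b) ≡ (b ==F a)
==F-sym Fin.zero    Fin.zero    = ≡.refl
==F-sym Fin.zero    (Fin.suc b) = ≡.refl
==F-sym (Fin.suc a) Fin.zero    = ≡.refl
==F-sym (Fin.suc a) (Fin.suc b) = ==F-sym a b

avoidsᵇ-∷ : ∀ {n m} (a b : Fin m) (f : Fin n → Fin m) →
            avoidsᵇ a (b ∷ᶠ f) ≡ not (a ==F b) ∧ avoidsᵇ a f
avoidsᵇ-∷ a b f = allB-suc (λ y → not (a ==F (b ∷ᶠ f) y))

injectiveᵇ-∷ : ∀ {n} (a : Fin (suc n)) (f : Fin n → Fin (suc n)) →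
               injectiveᵇ (a ∷ᶠ f) ≡ avoidsᵇ a f ∧ injectiveᵇ f
injectiveᵇ-∷ {n} a f = begin
  injectiveᵇ (a ∷ᶠ f)
    ≡⟨ allB-suc (λ x → allB (λ y → (x ==F y) ∨ not ((a ∷ᶠ f) x ==F (a ∷ᶠ f) y))) ⟩
  allB (λ y → (Fin.zero ==F y) ∨ not (a ==F (a ∷ᶠ f) y))
    ∧ allB (λ x → allB (λ y → (Fin.suc x ==F y) ∨ not (f x ==F (a ∷ᶠ f) y)))
    ≡⟨ ≡.cong₂ _∧_ (allB-suc (λ y → (Fin.zero ==F y) ∨ not (a ==F (a ∷ᶠ f) y)))
                   (allB-cong (λ x → allB-suc (λ y → (Fin.suc x ==F y) ∨ not (f x ==F (a ∷ᶠ f) y)))) ⟩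
  avoidsᵇ a f ∧ allB (λ x → not (f x ==F a) ∧ allB (λ y → (x ==F y) ∨ not (f x ==F f y)))
    ≡⟨ ≡.cong (avoidsᵇ a f ∧_) (allB-∧ n _ _) ⟩
  avoidsᵇ a f ∧ (allB (λ x → not (f x ==F a)) ∧ injectiveᵇ f)
    ≡⟨ ≡.cong (λ z → avoidsᵇ a f ∧ (z ∧ injectiveᵇ f)) (allB-cong λ x → ≡.cong not (==F-sym (f x) a)) ⟩
  avoidsᵇ a f ∧ (avoidsᵇ a f ∧ injectiveᵇ f)
    ≡⟨ ∧-assoc (avoidsᵇ a f) _ _ ⟨
  (avoidsᵇ a f ∧ avoidsᵇ a f) ∧ injectiveᵇ f
    ≡⟨ ≡.cong (_∧ injectiveᵇ f) (∧-idem _) ⟩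
  avoidsᵇ a f ∧ injectiveᵇ f ∎
  where open ≡.≡-Reasoning

injectiveᵇ-punchIn : ∀ {n m} (a : Fin (suc m)) (τ : Fin n → Fin m) →
                     injectiveᵇ (punchIn a ∘ τ) ≡ injectiveᵇ τ
injectiveᵇ-punchIn a τ = allB-cong λ x → allB-cong λ y →
  ≡.cong (λ z → (x ==F y) ∨ not z) (punchIn-==F a (τ x) (τ y))

_◂_ : ∀ {n} → Fin (suc n) → (Fin n → Fin n) → Fin (suc n) → Fin (suc n)
k ◂ τ = k ∷ᶠ (punchIn k ∘ τ)

perms′ : ∀ n → List (Fin n → Fin n)
perms′ zero    = (λ ()) ∷ []
perms′ (suc n) = concatMap (λ k → map (k ◂_) (perms′ n)) (allFin (suc n))

-- For endomaps of Fin n the reindexing property follows from surjectivity; carrying it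
-- along avoids a counting argument.
record IsPermutation {n} (τ : Fin n → Fin n) : Set where
  field
    surjective : ∀ y → ∃ λ x → τ x ≡ y
    ∑ℕ-reindex : ∀ g → ∑ℕ n (g ∘ τ) ≡ ∑ℕ n g

◂-isPermutation : ∀ {n} (k : Fin (suc n)) {τ : Fin n → Fin n} → IsPermutation τ → IsPermutation (k ◂ τ)
◂-isPermutation {n} k {τ} τ-perm = record { surjective = surjective ; ∑ℕ-reindex = ∑ℕ-reindex }
  where
  open IsPermutation τ-perm renaming (surjective to τ-surjective; ∑ℕ-reindex to τ-reindex)
  surjective : ∀ y → ∃ λ x → (k ◂ τ) x ≡ y
  surjective y with k Fin.≟ y
  ... | yes k≡y = Fin.zero , k≡y
  ... | no  k≢y with τ-surjective (Fin.punchOut k≢y)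
  ...   | x , τx≡y′ = Fin.suc x , ≡.trans (≡.cong (punchIn k) τx≡y′) (Fin.punchIn-punchOut k≢y)
  ∑ℕ-reindex : ∀ g → ∑ℕ (suc n) (g ∘ (k ◂ τ)) ≡ ∑ℕ (suc n) g
  ∑ℕ-reindex g = begin
    ∑ℕ (suc n) (g ∘ (k ◂ τ))            ≡⟨ ∑ℕ-suc n _ ⟩
    g k +ℕ ∑ℕ n (g ∘ punchIn k ∘ τ)      ≡⟨ ≡.cong (g k +ℕ_) (τ-reindex (g ∘ punchIn k)) ⟩
    g k +ℕ ∑ℕ n (g ∘ punchIn k)          ≡⟨ ∑ℕ-punchIn n k g ⟨
    ∑ℕ (suc n) g                         ∎
    where open ≡.≡-Reasoning

perms′-isPermutation : ∀ n → All IsPermutation (perms′ n)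
perms′-isPermutation zero    = record { surjective = λ () ; ∑ℕ-reindex = λ _ → ≡.refl } ∷ []
perms′-isPermutation (suc n) = All.concat⁺ (All.map⁺ (All.universal
  (λ k → All.gmap⁺ (◂-isPermutation k) (perms′-isPermutation n)) (allFin (suc n))))

inversions-◂ : ∀ {n} (k : Fin (suc n)) {τ : Fin n → Fin n} → IsPermutation τ →
               inversions (k ◂ τ) ≡ toℕ k +ℕ inversions τ
inversions-◂ {n} k {τ} τ-perm = begin
  inversions σ                         ≡⟨ ∑ℕ-suc n row ⟩
  row Fin.zero +ℕ ∑ℕ n (row ∘ Fin.suc)  ≡⟨ ≡.cong₂ _+ℕ_ row₀ (∑ℕ-cong n row-suc) ⟩
  toℕ k +ℕ inversions τ                ∎
  where
  open ≡.≡-Reasoning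
  σ : Fin (suc n) → Fin (suc n)
  σ = k ◂ τ
  inverted : Fin (suc n) → Fin (suc n) → ℕ
  inverted a b = if (a <F b) ∧ (σ b <F σ a) then 1 else 0
  row : Fin (suc n) → ℕ
  row a = ∑ℕ (suc n) (inverted a)
  row₀ : row Fin.zero ≡ toℕ k
  row₀ = begin
    row Fin.zero
      ≡⟨ ∑ℕ-suc n (inverted Fin.zero) ⟩
    ∑ℕ n (below (toℕ k) ∘ punchIn k ∘ τ)
      ≡⟨ ∑ℕ-cong n (≡.cong (if_then 1 else 0) ∘ punchIn-<ᵇ-pivot k ∘ τ) ⟩
    ∑ℕ n (below (toℕ k) ∘ τ)
      ≡⟨ IsPermutation.∑ℕ-reindex τ-perm (below (toℕ k)) ⟩
    ∑ℕ n (below (toℕ k))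
      ≡⟨ ∑ℕ-below n (toℕ k) (Fin.toℕ≤pred[n] k) ⟩
    toℕ k ∎
  row-suc : ∀ a → row (Fin.suc a) ≡ ∑ℕ n (λ b → if (a <F b) ∧ (τ b <F τ a) then 1 else 0)
  row-suc a = ≡.trans (∑ℕ-suc n (inverted (Fin.suc a)))
    (∑ℕ-cong n (λ b → ≡.cong (λ z → if (a <F b) ∧ z then 1 else 0) (punchIn-<F k (τ b) (τ a))))

inversions-cong : ∀ {n} {f g : Fin n → Fin n} → f ≗ g → inversions f ≡ inversions g
inversions-cong {n} f≗g = ∑ℕ-cong n λ a → ∑ℕ-cong n λ b →
  ≡.cong (λ z → if z then 1 else 0) (≡.cong₂ (λ u v → (a <F b) ∧ (u <F v)) (f≗g b) (f≗g a))

-- pfCond is pfOrdered at N = m * 2; allowing any codomain lets it be transported along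
-- order-preserving relabellings.
pairsIncreasing : ∀ {m N} → (Fin (m *ℕ 2) → Fin N) → Bool
pairsIncreasing {m} σ = allB (λ (i : Fin m) → σ (combine i Fin.zero) <F σ (combine i (Fin.suc Fin.zero)))

headsIncreasing : ∀ {m N} → (Fin (m *ℕ 2) → Fin N) → Bool
headsIncreasing {m} σ = allB (λ (i : Fin m) → allB (λ (j : Fin m) →
  not (toℕ j ≡ᵇ suc (toℕ i)) ∨ (σ (combine i Fin.zero) <F σ (combine j Fin.zero))))

pfOrdered : ∀ {m N} → (Fin (m *ℕ 2) → Fin N) → Bool
pfOrdered {m} σ = pairsIncreasing {m} σ ∧ headsIncreasing {m} σ

firstHeadLeast : ∀ {m N} → (Fin (suc m *ℕ 2) → Fin N) → Bool
firstHeadLeast {m} σ = allB (λ (j : Fin m) →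
  not (toℕ j ≡ᵇ 0) ∨ (σ Fin.zero <F σ (Fin.suc (Fin.suc (combine j Fin.zero)))))

pfOrdered-suc : ∀ {m N} (σ : Fin (suc m *ℕ 2) → Fin N) →
  pfOrdered {suc m} σ ≡ ((σ Fin.zero <F σ (Fin.suc Fin.zero)) ∧ pairsIncreasing {m} (σ ∘ Fin.suc ∘ Fin.suc))
                        ∧ (firstHeadLeast {m} σ ∧ headsIncreasing {m} (σ ∘ Fin.suc ∘ Fin.suc))
pfOrdered-suc {m} σ = ≡.cong₂ _∧_ (allB-suc pair)
  (≡.trans (allB-suc (λ i → allB (heads i)))
           (≡.cong₂ _∧_ (allB-suc (heads Fin.zero)) (allB-cong (λ i → allB-suc (heads (Fin.suc i))))))
  where
  pair : Fin (suc m) → Bool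
  pair i = σ (combine i Fin.zero) <F σ (combine i (Fin.suc Fin.zero))
  heads : Fin (suc m) → Fin (suc m) → Bool
  heads i j = not (toℕ j ≡ᵇ suc (toℕ i)) ∨ (σ (combine i Fin.zero) <F σ (combine j Fin.zero))

pfOrdered-cong : ∀ {m N} {f g : Fin (m *ℕ 2) → Fin N} → f ≗ g → pfOrdered {m} f ≡ pfOrdered {m} g
pfOrdered-cong {m} f≗g = ≡.cong₂ _∧_
  (allB-cong (λ (i : Fin m) → ≡.cong₂ _<F_ (f≗g _) (f≗g _)))
  (allB-cong (λ (i : Fin m) → allB-cong (λ (j : Fin m) →
    ≡.cong (not (toℕ j ≡ᵇ suc (toℕ i)) ∨_) (≡.cong₂ _<F_ (f≗g _) (f≗g _)))))

pfOrdered-relabel : ∀ {m N N′} (g : Fin N → Fin N′) → (∀ x y → (g x <F g y) ≡ (x <F y)) →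
                    (τ : Fin (m *ℕ 2) → Fin N) → pfOrdered {m} (g ∘ τ) ≡ pfOrdered {m} τ
pfOrdered-relabel {m} g g-mono τ = ≡.cong₂ _∧_
  (allB-cong (λ (i : Fin m) → g-mono _ _))
  (allB-cong (λ (i : Fin m) → allB-cong (λ (j : Fin m) →
    ≡.cong (not (toℕ j ≡ᵇ suc (toℕ i)) ∨_) (g-mono _ _))))

<F⇒≤ : ∀ {N} (a b : Fin N) → (a <F b) ≡ true → toℕ a ≤ toℕ b
<F⇒≤ a b a<b = ℕ.<⇒≤ (ℕ.<ᵇ⇒< (toℕ a) (toℕ b) (≡.subst T (≡.sym a<b) _))

pfOrdered-split : ∀ {m N} (σ : Fin (suc m *ℕ 2) → Fin N) → pfOrdered {suc m} σ ≡ true →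
  ((σ Fin.zero <F σ (Fin.suc Fin.zero)) ≡ true × firstHeadLeast {m} σ ≡ true)
  × pfOrdered {m} (σ ∘ Fin.suc ∘ Fin.suc) ≡ true
pfOrdered-split {m} σ ordered = split (≡.trans (≡.sym (pfOrdered-suc {m} σ)) ordered)
  where
  split : ∀ {a b c d} → (a ∧ b) ∧ (c ∧ d) ≡ true → (a ≡ true × c ≡ true) × b ∧ d ≡ true
  split {true} {true} {true} {true} _ = (≡.refl , ≡.refl) , ≡.refl

pfOrdered-head-least : ∀ m {N} (σ : Fin (suc m *ℕ 2) → Fin N) → pfOrdered {suc m} σ ≡ true →
                       ∀ x → toℕ (σ Fin.zero) ≤ toℕ (σ x)
pfOrdered-head-least m σ ordered Fin.zero = ℕ.≤-refl
pfOrdered-head-least m σ ordered (Fin.suc Fin.zero) =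
  <F⇒≤ _ _ (proj₁ (proj₁ (pfOrdered-split {m} σ ordered)))
pfOrdered-head-least (suc m) σ ordered (Fin.suc (Fin.suc x)) =
  ℕ.≤-trans (<F⇒≤ _ _ (allB-elim first≺ first-least Fin.zero))
            (pfOrdered-head-least m (σ ∘ Fin.suc ∘ Fin.suc) rest-ordered x)
  where
  first≺ : Fin (suc m) → Bool
  first≺ j = not (toℕ j ≡ᵇ 0) ∨ (σ Fin.zero <F σ (Fin.suc (Fin.suc (combine j Fin.zero))))
  first-least : allB first≺ ≡ true
  first-least = proj₂ (proj₁ (pfOrdered-split {suc m} σ ordered))
  rest-ordered : pfOrdered {suc m} (σ ∘ Fin.suc ∘ Fin.suc) ≡ true
  rest-ordered = proj₂ (pfOrdered-split {suc m} σ ordered)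

pfOrdered-◂◂ : ∀ m (j : Fin (suc (m *ℕ 2))) (τ : Fin (m *ℕ 2) → Fin (m *ℕ 2)) →
               pfOrdered {suc m} (Fin.zero ◂ (j ◂ τ)) ≡ pfOrdered {m} τ
pfOrdered-◂◂ m j τ = begin
  pfOrdered {suc m} σ
    ≡⟨ pfOrdered-suc {m} σ ⟩
  (true ∧ pairsIncreasing {m} σ″) ∧ (firstHeadLeast {m} σ ∧ headsIncreasing {m} σ″)
    ≡⟨ ≡.cong (λ b → pairsIncreasing {m} σ″ ∧ (b ∧ headsIncreasing {m} σ″))
              (≡.trans (allB-cong (λ (i : Fin m) → ∨-zeroʳ _)) (allB-true m)) ⟩
  pfOrdered {m} (Fin.suc ∘ punchIn j ∘ τ)
    ≡⟨ pfOrdered-relabel {m} (Fin.suc ∘ punchIn j) (punchIn-<F j) τ ⟩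
  pfOrdered {m} τ ∎
  where
  open ≡.≡-Reasoning
  σ : Fin (suc m *ℕ 2) → Fin (suc m *ℕ 2)
  σ = Fin.zero ◂ (j ◂ τ)
  σ″ : Fin (m *ℕ 2) → Fin (suc m *ℕ 2)
  σ″ = σ ∘ Fin.suc ∘ Fin.suc

module PermutationSums {c ℓ} (R : CommutativeRing c ℓ) where
  open CommutativeRing R
  open WithRing R using (signPow; ε)
  open ListSums R
  open import Algebra.Properties.Ring ring using (-‿distribˡ-*)
  open import Relation.Binary.Reasoning.Setoid setoid

  Respects≗ : ∀ {n m} → ((Fin n → Fin m) → Carrier) → Set _
  Respects≗ F = ∀ {f g} → f ≗ g → F f ≈ F g

  when-respects : ∀ {n m} {p : (Fin n → Fin m) → Bool} {F} →
                  (∀ {f g} → f ≗ g → p f ≡ p g) → Respects≗ F → Respects≗ (λ f → when (p f) (F f))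
  when-respects p-resp F-resp f≗g =
    trans (reflexive (when-≡ (p-resp f≗g))) (when-cong _ (F-resp f≗g))

  ∑-allFuns-suc : ∀ n m (F : (Fin (suc n) → Fin m) → Carrier) → Respects≗ F →
    ∑ (allFuns (suc n) m) F ≈ ∑ (allFuns n m) (λ f → ∑ (allFin m) (λ a → F (a ∷ᶠ f)))
  ∑-allFuns-suc n m F F-resp = trans (∑-concatMap _ (allFuns n m) F) (∑-cong (allFuns n m) λ f →
    trans (reflexive (∑-map _ (allFin m) F))
          (∑-cong (allFin m) (λ a → F-resp (∷-cong ≡.refl (λ _ → ≡.refl)))))

  ∑-≢ : ∀ m (a : Fin (suc m)) (G : Fin (suc m) → Carrier) →
        ∑ (allFin (suc m)) (λ b → when (not (a ==F b)) (G b)) ≈ ∑ (allFin m) (G ∘ punchIn a)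
  ∑-≢ m       Fin.zero    G = trans (∑-allFin-suc (λ b → when (not (Fin.zero ==F b)) (G b))) (+-identityˡ _)
  ∑-≢ (suc m) (Fin.suc a) G = begin
    ∑ (allFin (suc (suc m))) (λ b → when (not (Fin.suc a ==F b)) (G b))
      ≈⟨ ∑-allFin-suc (λ b → when (not (Fin.suc a ==F b)) (G b)) ⟩
    G Fin.zero + ∑ (allFin (suc m)) (λ b → when (not (a ==F b)) (G (Fin.suc b)))
      ≈⟨ +-congˡ (∑-≢ m a (G ∘ Fin.suc)) ⟩
    G Fin.zero + ∑ (allFin m) (G ∘ Fin.suc ∘ punchIn a)
      ≈⟨ ∑-allFin-suc (G ∘ punchIn (Fin.suc a)) ⟨
    ∑ (allFin (suc m)) (G ∘ punchIn (Fin.suc a)) ∎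

  ∑-avoiding : ∀ n m (a : Fin (suc m)) (H : (Fin n → Fin (suc m)) → Carrier) → Respects≗ H →
    ∑ (allFuns n (suc m)) (λ f → when (avoidsᵇ a f) (H f)) ≈ ∑ (allFuns n m) (λ τ → H (punchIn a ∘ τ))
  ∑-avoiding zero    m a H H-resp = +-congʳ (H-resp (λ ()))
  ∑-avoiding (suc n) m a H H-resp = begin
    ∑ (allFuns (suc n) (suc m)) (λ f → when (avoidsᵇ a f) (H f))
      ≈⟨ ∑-allFuns-suc n (suc m) _ (when-respects (avoidsᵇ-cong a) H-resp) ⟩
    ∑ Fs (λ f → ∑ (allFin (suc m)) (λ b → when (avoidsᵇ a (b ∷ᶠ f)) (H (b ∷ᶠ f))))
      ≈⟨ ∑-cong Fs (λ f → ∑-cong (allFin (suc m)) λ b → reflexive (≡.trans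
           (when-≡ (avoidsᵇ-∷ a b f)) (when-∧ (not (a ==F b)) (avoidsᵇ a f) _))) ⟩
    ∑ Fs (λ f → ∑ (allFin (suc m)) (λ b → when (not (a ==F b)) (H′ b f)))
      ≈⟨ ∑-swap Fs (allFin (suc m)) _ ⟩
    ∑ (allFin (suc m)) (λ b → ∑ Fs (λ f → when (not (a ==F b)) (H′ b f)))
      ≈⟨ ∑-cong (allFin (suc m)) (λ b → ∑-when Fs _ _) ⟩
    ∑ (allFin (suc m)) (λ b → when (not (a ==F b)) (∑ Fs (H′ b)))
      ≈⟨ ∑-cong (allFin (suc m)) (λ b → when-cong _
           (∑-avoiding n m a (λ f → H (b ∷ᶠ f)) (λ f≗g → H-resp (∷-cong ≡.refl f≗g)))) ⟩
    ∑ (allFin (suc m)) (λ b → when (not (a ==F b)) (∑ (allFuns n m) (λ τ → H (b ∷ᶠ (punchIn a ∘ τ)))))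
      ≈⟨ ∑-≢ m a _ ⟩
    ∑ (allFin m) (λ c → ∑ (allFuns n m) (λ τ → H (punchIn a c ∷ᶠ (punchIn a ∘ τ))))
      ≈⟨ ∑-swap (allFin m) (allFuns n m) _ ⟩
    ∑ (allFuns n m) (λ τ → ∑ (allFin m) (λ c → H (punchIn a c ∷ᶠ (punchIn a ∘ τ))))
      ≈⟨ ∑-cong (allFuns n m) (λ τ → ∑-cong (allFin m) λ c → H-resp (∷-cong ≡.refl (λ _ → ≡.refl))) ⟩
    ∑ (allFuns n m) (λ τ → ∑ (allFin m) (λ c → H (punchIn a ∘ (c ∷ᶠ τ))))
      ≈⟨ ∑-allFuns-suc n m (λ τ → H (punchIn a ∘ τ)) (λ f≗g → H-resp (≡.cong (punchIn a) ∘ f≗g)) ⟨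
    ∑ (allFuns (suc n) m) (λ τ → H (punchIn a ∘ τ)) ∎
    where
    Fs : List (Fin n → Fin (suc m))
    Fs = allFuns n (suc m)
    H′ : Fin (suc m) → (Fin n → Fin (suc m)) → Carrier
    H′ b f = when (avoidsᵇ a f) (H (b ∷ᶠ f))

  ∑-perms-suc : ∀ n (F : (Fin (suc n) → Fin (suc n)) → Carrier) → Respects≗ F →
    ∑ (perms (suc n)) F ≈ ∑ (allFin (suc n)) (λ k → ∑ (perms n) (λ τ → F (k ◂ τ)))
  ∑-perms-suc n F F-resp = begin
    ∑ (perms (suc n)) F
      ≈⟨ ∑-filterᵇ isInjective (allFuns (suc n) (suc n)) F ⟩
    ∑ (allFuns (suc n) (suc n)) (λ f → when (injectiveᵇ f) (F f))
      ≈⟨ ∑-allFuns-suc n (suc n) _ (when-respects injectiveᵇ-cong F-resp) ⟩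
    ∑ Fs (λ f → ∑ (allFin (suc n)) (λ k → when (injectiveᵇ (k ∷ᶠ f)) (F (k ∷ᶠ f))))
      ≈⟨ ∑-swap Fs (allFin (suc n)) _ ⟩
    ∑ (allFin (suc n)) (λ k → ∑ Fs (λ f → when (injectiveᵇ (k ∷ᶠ f)) (F (k ∷ᶠ f))))
      ≈⟨ ∑-cong (allFin (suc n)) (λ k → ∑-cong Fs λ f → reflexive (≡.trans
           (when-≡ (injectiveᵇ-∷ k f)) (when-∧ (avoidsᵇ k f) (injectiveᵇ f) _))) ⟩
    ∑ (allFin (suc n)) (λ k → ∑ Fs (λ f → when (avoidsᵇ k f) (when (injectiveᵇ f) (F (k ∷ᶠ f)))))
      ≈⟨ ∑-cong (allFin (suc n)) (λ k → ∑-avoiding n n k _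
           (when-respects injectiveᵇ-cong (λ f≗g → F-resp (∷-cong ≡.refl f≗g)))) ⟩
    ∑ (allFin (suc n)) (λ k → ∑ (allFuns n n) (λ τ → when (injectiveᵇ (punchIn k ∘ τ)) (F (k ◂ τ))))
      ≈⟨ ∑-cong (allFin (suc n)) (λ k → ∑-cong (allFuns n n) λ τ →
           reflexive (when-≡ (injectiveᵇ-punchIn k τ))) ⟩
    ∑ (allFin (suc n)) (λ k → ∑ (allFuns n n) (λ τ → when (injectiveᵇ τ) (F (k ◂ τ))))
      ≈⟨ ∑-cong (allFin (suc n)) (λ k → ∑-filterᵇ isInjective (allFuns n n) _) ⟨
    ∑ (allFin (suc n)) (λ k → ∑ (perms n) (λ τ → F (k ◂ τ))) ∎
    where
    Fs : List (Fin n → Fin (suc n))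
    Fs = allFuns n (suc n)

  ∑-perms′-suc : ∀ n (F : (Fin (suc n) → Fin (suc n)) → Carrier) →
    ∑ (perms′ (suc n)) F ≈ ∑ (allFin (suc n)) (λ k → ∑ (perms′ n) (λ τ → F (k ◂ τ)))
  ∑-perms′-suc n F = trans (∑-concatMap (λ k → map (k ◂_) (perms′ n)) (allFin (suc n)) F)
    (∑-cong (allFin (suc n)) (λ k → reflexive (∑-map (k ◂_) (perms′ n) F)))

  ∑-perms≈∑-perms′ : ∀ n (F : (Fin n → Fin n) → Carrier) → Respects≗ F →
                     ∑ (perms n) F ≈ ∑ (perms′ n) F
  ∑-perms≈∑-perms′ zero    F F-resp = +-congʳ (F-resp (λ ()))
  ∑-perms≈∑-perms′ (suc n) F F-resp = begin
    ∑ (perms (suc n)) F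
      ≈⟨ ∑-perms-suc n F F-resp ⟩
    ∑ (allFin (suc n)) (λ k → ∑ (perms n) (λ τ → F (k ◂ τ)))
      ≈⟨ ∑-cong (allFin (suc n)) (λ k →
           ∑-perms≈∑-perms′ n _ (λ f≗g → F-resp (∷-cong ≡.refl (≡.cong (punchIn k) ∘ f≗g)))) ⟩
    ∑ (allFin (suc n)) (λ k → ∑ (perms′ n) (λ τ → F (k ◂ τ)))
      ≈⟨ ∑-perms′-suc n F ⟨
    ∑ (perms′ (suc n)) F ∎

  signPow-+ : ∀ a b → signPow (a +ℕ b) ≈ signPow a * signPow b
  signPow-+ zero    b = sym (*-identityˡ _)
  signPow-+ (suc a) b = trans (-‿cong (signPow-+ a b)) (-‿distribˡ-* _ _)

  ε-cong : ∀ {n} {f g : Fin n → Fin n} → f ≗ g → ε f ≈ ε g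
  ε-cong f≗g = reflexive (≡.cong signPow (inversions-cong f≗g))

  ε-◂ : ∀ {n} (k : Fin (suc n)) {τ : Fin n → Fin n} → IsPermutation τ →
        ε (k ◂ τ) ≈ signPow (toℕ k) * ε τ
  ε-◂ k τ-perm = trans (reflexive (≡.cong signPow (inversions-◂ k τ-perm))) (signPow-+ (toℕ k) _)

module AlternantRecursion {c ℓ} (R : CommutativeRing c ℓ) where
  open CommutativeRing R
  open WithRing R using (signPow; ε; M; pow; listOf; V)
  open ListSums R
  open PermutationSums R
  open Alternating R ℕ
  open QuasiSymmetricLists R using (V′)
  open import Algebra.Properties.CommutativeSemigroup *-commutativeSemigroup using (x∙yz≈y∙xz)
  open import Algebra.Properties.Ring ring using (-0#≈0#; -‿distribˡ-*)
  open import Relation.Binary.Reasoning.Setoid setoid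

  alt-listOf : ∀ n (I : Fin (suc n) → ℕ) (F : ℕ → List ℕ → Carrier) →
    alt (listOf I) F ≈ ∑ (allFin (suc n)) (λ k → signPow (toℕ k) * F (I k) (listOf (I ∘ punchIn k)))
  alt-listOf zero    I F = begin
    F (I Fin.zero) [] - 0#        ≈⟨ +-congˡ -0#≈0# ⟩
    F (I Fin.zero) [] + 0#        ≈⟨ +-congʳ (*-identityˡ _) ⟨
    1# * F (I Fin.zero) [] + 0#   ∎
  alt-listOf (suc n) I F = begin
    alt (listOf I) F
      ≡⟨ ≡.cong (λ L → alt L F) (map-allFin-suc I) ⟩
    F I₀ (listOf (I ∘ Fin.suc)) - alt (listOf (I ∘ Fin.suc)) (λ b L → F b (I₀ ∷ L))
      ≈⟨ +-congˡ (-‿cong (alt-listOf n (I ∘ Fin.suc) (λ b L → F b (I₀ ∷ L)))) ⟩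
    F I₀ (listOf (I ∘ Fin.suc)) - ∑ (allFin (suc n)) tailTerm
      ≈⟨ +-cong (sym (*-identityˡ _))
                (trans (sym (∑-neg (allFin (suc n)) tailTerm)) (∑-cong (allFin (suc n)) shift)) ⟩
    1# * F I₀ (listOf (I ∘ Fin.suc)) + ∑ (allFin (suc n)) (term ∘ Fin.suc)
      ≈⟨ ∑-allFin-suc term ⟨
    ∑ (allFin (suc (suc n))) term ∎
    where
    I₀ : ℕ
    I₀ = I Fin.zero
    term : Fin (suc (suc n)) → Carrier
    term k = signPow (toℕ k) * F (I k) (listOf (I ∘ punchIn k))
    tailTerm : Fin (suc n) → Carrier
    tailTerm k = signPow (toℕ k) * F (I (Fin.suc k)) (I₀ ∷ listOf (I ∘ Fin.suc ∘ punchIn k))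
    shift : ∀ k → - tailTerm k ≈ term (Fin.suc k)
    shift k = trans (-‿distribˡ-* _ _)
      (*-congˡ (reflexive (≡.cong (F (I (Fin.suc k))) (≡.sym (map-allFin-suc (I ∘ punchIn (Fin.suc k)))))))

  V-perms′ : ∀ {r} → (Fin r → ℕ) → List Carrier → Carrier
  V-perms′ {r} I xs = ∑ (perms′ r) (λ σ → ε σ * M (listOf (I ∘ σ)) xs)

  V≈V-perms′ : ∀ {r} (I : Fin r → ℕ) xs → V I xs ≈ V-perms′ I xs
  V≈V-perms′ {r} I xs = ∑-perms≈∑-perms′ r _ λ f≗g →
    *-cong (ε-cong f≗g) (reflexive (≡.cong (λ L → M L xs) (List.map-cong (≡.cong I ∘ f≗g) (allFin r))))

  M-listOf-∷ : ∀ r (J : Fin (suc r) → ℕ) y ys →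
               M (listOf J) (y ∷ ys) ≈ pow y (J Fin.zero) * M (listOf (J ∘ Fin.suc)) ys + M (listOf J) ys
  M-listOf-∷ r J y ys = trans (reflexive (≡.cong (λ L → M L (y ∷ ys)) (map-allFin-suc J)))
                              (+-congˡ (reflexive (≡.cong (λ L → M L ys) (≡.sym (map-allFin-suc J)))))

  V-perms′-∷ : ∀ r (I : Fin (suc r) → ℕ) y ys →
    V-perms′ I (y ∷ ys)
    ≈ V-perms′ I ys + ∑ (allFin (suc r)) (λ k → signPow (toℕ k) * (pow y (I k) * V-perms′ (I ∘ punchIn k) ys))
  V-perms′-∷ r I y ys = begin
    ∑ (perms′ (suc r)) (λ σ → ε σ * M (listOf (I ∘ σ)) (y ∷ ys))
      ≈⟨ ∑-cong (perms′ (suc r)) (λ σ → trans (*-congˡ (M-listOf-∷ r (I ∘ σ) y ys)) (distribˡ _ _ _)) ⟩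
    ∑ (perms′ (suc r)) (λ σ → leading σ + ε σ * M (listOf (I ∘ σ)) ys)
      ≈⟨ trans (∑-+ (perms′ (suc r)) _ _) (+-comm _ _) ⟩
    V-perms′ I ys + ∑ (perms′ (suc r)) leading
      ≈⟨ +-congˡ (∑-perms′-suc r leading) ⟩
    V-perms′ I ys + ∑ (allFin (suc r)) (λ k → ∑ (perms′ r) (λ τ → leading (k ◂ τ)))
      ≈⟨ +-congˡ (∑-cong (allFin (suc r)) λ k → trans (∑-cong-All (perms′-isPermutation r) (λ τ → regroup k))
                                                      (trans (∑-* (perms′ r) _ _) (*-congˡ (∑-* (perms′ r) _ _)))) ⟩
    V-perms′ I ys + ∑ (allFin (suc r)) (λ k → signPow (toℕ k) * (pow y (I k) * V-perms′ (I ∘ punchIn k) ys)) ∎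
    where
    leading : (Fin (suc r) → Fin (suc r)) → Carrier
    leading σ = ε σ * (pow y (I (σ Fin.zero)) * M (listOf (I ∘ σ ∘ Fin.suc)) ys)
    regroup : ∀ k {τ} → IsPermutation τ →
              leading (k ◂ τ) ≈ signPow (toℕ k) * (pow y (I k) * (ε τ * M (listOf (I ∘ punchIn k ∘ τ)) ys))
    regroup k τ-perm = trans (*-congʳ (ε-◂ k τ-perm)) (trans (*-assoc _ _ _) (*-congˡ (x∙yz≈y∙xz _ _ _)))

  V′-[] : ∀ xs → V′ [] xs ≈ 1#
  V′-[] []       = refl
  V′-[] (y ∷ ys) = trans (+-identityʳ _) (V′-[] ys)

  V-perms′≈V′ : ∀ xs r (I : Fin r → ℕ) → V-perms′ I xs ≈ V′ (listOf I) xs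
  V-perms′≈V′ xs       zero    I = trans (+-identityʳ _) (trans (*-identityˡ _) (sym (V′-[] xs)))
  V-perms′≈V′ []       (suc r) I = ∑-0 (perms′ (suc r)) (λ σ → zeroʳ _)
  V-perms′≈V′ (y ∷ ys) (suc r) I = begin
    V-perms′ I (y ∷ ys)
      ≈⟨ V-perms′-∷ r I y ys ⟩
    V-perms′ I ys + ∑ (allFin (suc r)) (λ k → signPow (toℕ k) * (pow y (I k) * V-perms′ (I ∘ punchIn k) ys))
      ≈⟨ +-cong (V-perms′≈V′ ys (suc r) I)
                (∑-cong (allFin (suc r)) λ k → *-congˡ (*-congˡ (V-perms′≈V′ ys r (I ∘ punchIn k)))) ⟩
    V′ (listOf I) ys + ∑ (allFin (suc r)) (λ k → signPow (toℕ k) * (pow y (I k) * V′ (listOf (I ∘ punchIn k)) ys))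
      ≈⟨ +-congˡ (alt-listOf r I (λ b L′ → pow y b * V′ L′ ys)) ⟨
    V′ (listOf I) (y ∷ ys) ∎

  V≈V′ : ∀ {r} (I : Fin r → ℕ) xs → V I xs ≈ V′ (listOf I) xs
  V≈V′ {r} I xs = trans (V≈V-perms′ I xs) (V-perms′≈V′ xs r I)

module PfaffianExpansion {c ℓ} (R : CommutativeRing c ℓ) where
  open CommutativeRing R
  open WithRing R using (signPow; ε; prodR; Pf; listOf)
  open ListSums R
  open PermutationSums R
  open Alternating R ℕ using (alt)
  open ListPfaffian R ℕ using (pf; pf-∷)
  open AlternantRecursion R using (alt-listOf)
  open import Algebra.Properties.CommutativeSemigroup *-commutativeSemigroup using (x∙yz≈y∙xz)
  open import Relation.Binary.Reasoning.Setoid setoid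

  pairProduct : ∀ m {N} → (Fin N → Fin N → Carrier) → (Fin (m *ℕ 2) → Fin N) → Carrier
  pairProduct m A σ =
    prodR (map (λ (i : Fin m) → A (σ (combine i Fin.zero)) (σ (combine i (Fin.suc Fin.zero)))) (allFin m))

  pfTerm : ∀ m → (Fin (m *ℕ 2) → Fin (m *ℕ 2) → Carrier) → (Fin (m *ℕ 2) → Fin (m *ℕ 2)) → Carrier
  pfTerm m A σ = when (pfOrdered {m} σ) (ε σ * pairProduct m A σ)

  Pf′ : ∀ m → (Fin (m *ℕ 2) → Fin (m *ℕ 2) → Carrier) → Carrier
  Pf′ m A = ∑ (perms′ (m *ℕ 2)) (pfTerm m A)

  Pf≈Pf′ : ∀ m A → Pf m A ≈ Pf′ m A
  Pf≈Pf′ m A = trans (∑-filterᵇ (pfCond {m}) (perms (m *ℕ 2)) _)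
    (∑-perms≈∑-perms′ (m *ℕ 2) (pfTerm m A) (when-respects (pfOrdered-cong {m}) λ f≗g →
      *-cong (ε-cong f≗g)
             (reflexive (≡.cong prodR (List.map-cong (λ _ → ≡.cong₂ A (f≗g _) (f≗g _)) (allFin m))))))

  when-scale : ∀ b {x y} s a → x ≈ s * (a * y) → when b x ≈ s * (a * when b y)
  when-scale true  s a x≈ = x≈
  when-scale false s a _  = sym (trans (*-congˡ (zeroʳ a)) (zeroʳ s))

  minor : ∀ {n} → (Fin (suc (suc n)) → Fin (suc (suc n)) → Carrier) → Fin (suc n) → Fin n → Fin n → Carrier
  minor A j p q = A (Fin.suc (punchIn j p)) (Fin.suc (punchIn j q))

  -- In an ordered σ the entry σ 0 is least, so only σ with σ 0 = 0 contribute; such a σ is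
  -- 0 ◂ (j ◂ τ), which pairs 0 with j + 1 and orders the remaining pairs by τ.
  Pf′-suc : ∀ m A → Pf′ (suc m) A ≈ ∑ (allFin (suc (m *ℕ 2))) (λ j →
                      signPow (toℕ j) * (A Fin.zero (Fin.suc j) * Pf′ m (minor A j)))
  Pf′-suc m A = begin
    Pf′ (suc m) A
      ≈⟨ ∑-perms′-suc (suc n) _ ⟩
    ∑ (allFin (suc (suc n))) (λ k → ∑ (perms′ (suc n)) (λ ρ → pfTerm (suc m) A (k ◂ ρ)))
      ≈⟨ ∑-allFin-suc (λ k → ∑ (perms′ (suc n)) (λ ρ → pfTerm (suc m) A (k ◂ ρ))) ⟩
    ∑ (perms′ (suc n)) (λ ρ → pfTerm (suc m) A (Fin.zero ◂ ρ))
      + ∑ (allFin (suc n)) (λ k → ∑ (perms′ (suc n)) (λ ρ → pfTerm (suc m) A (Fin.suc k ◂ ρ)))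
      ≈⟨ +-cong (∑-perms′-suc n _) (∑-0 (allFin (suc n)) λ k →
           trans (∑-cong-All (perms′-isPermutation (suc n)) (λ ρ → vanishes k))
                 (∑-0 (perms′ (suc n)) (λ _ → refl))) ⟩
    ∑ (allFin (suc n)) (λ j → ∑ (perms′ n) (λ τ → pfTerm (suc m) A (Fin.zero ◂ (j ◂ τ)))) + 0#
      ≈⟨ +-identityʳ _ ⟩
    ∑ (allFin (suc n)) (λ j → ∑ (perms′ n) (λ τ → pfTerm (suc m) A (Fin.zero ◂ (j ◂ τ))))
      ≈⟨ ∑-cong (allFin (suc n)) (λ j → trans (∑-cong-All (perms′-isPermutation n) (λ τ → pfTerm-◂◂ j))
                                               (trans (∑-* (perms′ n) _ _) (*-congˡ (∑-* (perms′ n) _ _)))) ⟩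
    ∑ (allFin (suc n)) (λ j → signPow (toℕ j) * (A Fin.zero (Fin.suc j) * Pf′ m (minor A j))) ∎
    where
    n : ℕ
    n = m *ℕ 2

    vanishes : ∀ k {ρ} → IsPermutation ρ → pfTerm (suc m) A (Fin.suc k ◂ ρ) ≈ 0#
    vanishes k {ρ} ρ-perm = begin
      when (pfOrdered {suc m} σ) (ε σ * pairProduct (suc m) A σ)  ≡⟨ when-≡ (¬-not unordered) ⟩
      when false (ε σ * pairProduct (suc m) A σ)                  ∎
      where
      σ : Fin (suc m *ℕ 2) → Fin (suc m *ℕ 2)
      σ = Fin.suc k ◂ ρ
      unordered : pfOrdered {suc m} σ ≢ true
      unordered ordered with x , σx≡0 ← IsPermutation.surjective (◂-isPermutation (Fin.suc k) ρ-perm) Fin.zero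
        with () ← ≡.subst (λ z → suc (toℕ k) ≤ toℕ z) σx≡0 (pfOrdered-head-least m σ ordered x)

    pfTerm-◂◂ : ∀ j {τ} → IsPermutation τ → pfTerm (suc m) A (Fin.zero ◂ (j ◂ τ))
                ≈ signPow (toℕ j) * (A Fin.zero (Fin.suc j) * pfTerm m (minor A j) τ)
    pfTerm-◂◂ j {τ} τ-perm = begin
      when (pfOrdered {suc m} σ) (ε σ * pairProduct (suc m) A σ)
        ≡⟨ when-≡ (pfOrdered-◂◂ m j τ) ⟩
      when (pfOrdered {m} τ) (ε σ * pairProduct (suc m) A σ)
        ≈⟨ when-scale (pfOrdered {m} τ) _ _ (begin
             ε σ * pairProduct (suc m) A σ
               ≈⟨ *-cong (trans (ε-◂ Fin.zero (◂-isPermutation j τ-perm)) (*-congˡ (ε-◂ j τ-perm)))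
                         (reflexive (≡.cong prodR (map-allFin-suc (λ (i : Fin (suc m)) →
                           A (σ (combine i Fin.zero)) (σ (combine i (Fin.suc Fin.zero))))))) ⟩
             (1# * (signPow (toℕ j) * ε τ)) * (A Fin.zero (Fin.suc j) * pairProduct m (minor A j) τ)
               ≈⟨ trans (*-congʳ (*-identityˡ _)) (trans (*-assoc _ _ _) (*-congˡ (x∙yz≈y∙xz _ _ _))) ⟩
             signPow (toℕ j) * (A Fin.zero (Fin.suc j) * (ε τ * pairProduct m (minor A j) τ)) ∎) ⟩
      signPow (toℕ j) * (A Fin.zero (Fin.suc j) * pfTerm m (minor A j) τ) ∎
      where
      σ : Fin (suc m *ℕ 2) → Fin (suc m *ℕ 2)
      σ = Fin.zero ◂ (j ◂ τ)

  Pf′≈pf : ∀ m (L : Fin (m *ℕ 2) → ℕ) (B : ℕ → ℕ → Carrier) →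
           Pf′ m (λ p q → B (L p) (L q)) ≈ pf B (listOf L)
  Pf′≈pf zero    L B = trans (+-identityʳ _) (*-identityˡ _)
  Pf′≈pf (suc m) L B = begin
    Pf′ (suc m) (λ p q → B (L p) (L q))
      ≈⟨ Pf′-suc m (λ p q → B (L p) (L q)) ⟩
    ∑ (allFin (suc n)) (λ j → signPow (toℕ j) * (B L₀ (L (Fin.suc j)) * Pf′ m (minor (λ p q → B (L p) (L q)) j)))
      ≈⟨ ∑-cong (allFin (suc n)) (λ j → *-congˡ (*-congˡ (Pf′≈pf m (L ∘ Fin.suc ∘ punchIn j) B))) ⟩
    ∑ (allFin (suc n)) (λ j → signPow (toℕ j) * (B L₀ (L (Fin.suc j)) * pf B (listOf (L ∘ Fin.suc ∘ punchIn j))))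
      ≈⟨ alt-listOf n (L ∘ Fin.suc) (λ b L′ → B L₀ b * pf B L′) ⟨
    alt (listOf (L ∘ Fin.suc)) (λ b L′ → B L₀ b * pf B L′)
      ≈⟨ pf-∷ B L₀ (listOf (L ∘ Fin.suc)) ⟨
    pf B (L₀ ∷ listOf (L ∘ Fin.suc))
      ≡⟨ ≡.cong (pf B) (map-allFin-suc L) ⟨
    pf B (listOf L) ∎
    where
    n : ℕ
    n = m *ℕ 2
    L₀ : ℕ
    L₀ = L Fin.zero

  Pf≈pf : ∀ m (L : Fin (m *ℕ 2) → ℕ) (B : ℕ → ℕ → Carrier) →
          Pf m (λ p q → B (L p) (L q)) ≈ pf B (listOf L)
  Pf≈pf m L B = trans (Pf≈Pf′ m (λ p q → B (L p) (L q))) (Pf′≈pf m L B)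


length-listOf : ∀ {n} (I : Fin n → ℕ) → length (map I (allFin n)) ≡ n
length-listOf {n} I = ≡.trans (List.length-map I (allFin n)) (List.length-tabulate id)

mainTheorem6 : ∀ {c ℓ : Level} (R : CommutativeRing c ℓ) →
    let open CommutativeRing R
        open WithRing R
    in (∀ (m : ℕ) (I : Fin (m *ℕ 2) → ℕ) →
          (∀ a → 1 ≤ I a) → (∀ a b → a <ᶠ b → I a < I b) →
          ∀ (xs : List Carrier) →
          V I xs ≈ Pf m (λ p q → Q xs (I p) (I q)))
     × (∀ (m : ℕ) (I : Fin (suc (m *ℕ 2)) → ℕ) →
          (∀ a → 1 ≤ I a) → (∀ a b → a <ᶠ b → I a < I b) →
          ∀ (xs : List Carrier) →
          V I xs ≈ sumR (map (λ k → signPow (toℕ k) * (M (I k Data.List.∷ Data.List.[]) xs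
                      * Pf m (λ p q → Q xs (I (punchIn k p)) (I (punchIn k q))))) (allFin (suc (m *ℕ 2)))))
mainTheorem6 R = (λ m I _ _ → even m I) , (λ m I _ _ → odd m I)
  where
  open CommutativeRing R
  open WithRing R
  open ListSums R using (∑-cong)
  open ListPfaffian R ℕ using (pf; pfBorder)
  open QuasiSymmetricLists R using (V′; V′-even; V′-odd)
  open AlternantRecursion R using (V≈V′; alt-listOf)
  open PfaffianExpansion R using (Pf≈pf)
  open import Relation.Binary.Reasoning.Setoid setoid

  even : ∀ m (I : Fin (m *ℕ 2) → ℕ) xs → V I xs ≈ Pf m (λ p q → Q xs (I p) (I q))
  even m I xs = begin
    V I xs                                ≈⟨ V≈V′ I xs ⟩
    V′ (listOf I) xs                      ≈⟨ V′-even xs m (listOf I) (length-listOf I) ⟩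
    pf (Q xs) (listOf I)                  ≈⟨ Pf≈pf m I (Q xs) ⟨
    Pf m (λ p q → Q xs (I p) (I q))       ∎

  odd : ∀ m (I : Fin (suc (m *ℕ 2)) → ℕ) xs →
        V I xs ≈ sumR (map (λ k → signPow (toℕ k) * (M (I k ∷ []) xs
                   * Pf m (λ p q → Q xs (I (punchIn k p)) (I (punchIn k q))))) (allFin (suc (m *ℕ 2))))
  odd m I xs = begin
    V I xs
      ≈⟨ V≈V′ I xs ⟩
    V′ (listOf I) xs
      ≈⟨ V′-odd xs m (listOf I) (length-listOf I) ⟩
    pfBorder (λ b → M (b ∷ []) xs) (Q xs) (listOf I)
      ≈⟨ alt-listOf (m *ℕ 2) I (λ b L′ → M (b ∷ []) xs * pf (Q xs) L′) ⟩
    sumR (map (λ k → signPow (toℕ k) * (M (I k ∷ []) xs * pf (Q xs) (listOf (I ∘ punchIn k))))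
              (allFin (suc (m *ℕ 2))))
      ≈⟨ ∑-cong (allFin (suc (m *ℕ 2))) (λ k → *-congˡ (*-congˡ (Pf≈pf m (I ∘ punchIn k) (Q xs)))) ⟨
    sumR (map (λ k → signPow (toℕ k) * (M (I k ∷ []) xs
      * Pf m (λ p q → Q xs (I (punchIn k p)) (I (punchIn k q))))) (allFin (suc (m *ℕ 2)))) ∎
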